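{- Let $A$ be an $n\times n$ matrix. Let $3\le k\le n$, and suppose Dodgson's method applied to $A$ has produced $A^{(n)}=A,\dots,A^{(k)}$ without division by zero. Suppose the interior of $A^{(k)}$ contains a zero in row $i$ and column $j$ of $A^{(k)}$, where $2\le i,j\le k-1$. Let $r,s\in\{ -1,0,1\}$, and suppose the element $\alpha=A^{(k)}_{i+r,\,j+s}$ is non-zero. Let $\ell=n-k$. Let $\mathcal{A}$ be the $(\ell+3)\times(\ell+3)$ submatrix of $A$ whose upper left corner is the entry in row $i-1$ and column $j-1$ of $A$, i.e. $\mathcal{A}=A_{i-1\ldots i+\ell+1,\;j-1\ldots j+\ell+1}$. Let $M$ be the $(\ell+1)\times(\ell+1)$ submatrix of $\mathcal{A}$ whose upper left corner is the entry in row $r+2$ and column $s+2$ of $\mathcal{A}$, i.e. rows $r+2,\dots,r+2+\ell$ and columns $s+2,\dots,s+2+\ell$ of $\mathcal{A}$. Crossing out these rows and columns of $M$ leaves the $2\times 2$ complementary minor $M^*$, formed by the two remaining rows and two remaining columns of $\mathcal{A}$. Let $M'$ be the $2\times2$ matrix whose entry in each position is the minor in $\mathcal{A}$ of the corresponding element of $M^*$. Here the minor of the element in row $p$ and column $q$ of $\mathcal{A}$ is the determinant of $\mathcal{A}$ with row $p$ and column $q$ deleted. Then the element in row $i-1$ and column $j-1$ of $A^{(k-2)}$ can be computed as $\det M'/\alpha$. That is, \[ \frac{\det M'}{\alpha}=\det\mathcal{A}=\det A_{i-1\ldots i+\ell+1,\;j-1\ldots j+\ell+1}, \] which is the value that entry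 has in a successful run of Dodgson's method.
   Context: Notation: $A_{i\ldots j,\,k\ldots \ell}$ denotes the submatrix formed by rows $i,\dots,j$ and columns $k,\dots,\ell$ of $A$. The interior of an $m\times m$ matrix $X$ is the $(m-1)\times(m-1)$ matrix with $(p,q)$ entry $X_{p+1,q+1}$; an entry of $X$ is "in the interior" if it lies in rows $2,\dots,m-1$ and columns $2,\dots,m-1$. Dodgson's method for an $n\times n$ matrix $A$: set $A^{(n)}=A$. For $m=n-1,\dots,1$, let $B^{(m)}_{p,q}=A^{(m+1)}_{p,q}A^{(m+1)}_{p+1,q+1}-A^{(m+1)}_{p+1,q}A^{(m+1)}_{p,q+1}$ for $1\le p,q\le m$. Set $A^{(n-1)}=B^{(n-1)}$. For $m\le n-2$, set $A^{(m)}_{p,q}=B^{(m)}_{p,q}/A^{(m+2)}_{p+1,q+1}$. The method fails if one of these divisors is zero. When all steps succeed, $A^{(m)}_{p,q}=\det A_{p\ldots p+n-m,\;q\ldots q+n-m}$. In particular $A^{(k)}_{i+r,j+s}=\det A_{i+r\ldots i+r+\ell,\;j+s\ldots j+s+\ell}$. -}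

module Defs where

open import Level using (Level; _⊔_) renaming (suc to lsuc)
open import Data.Nat using (ℕ; zero; suc; _∸_; _<ᵇ_)
import Data.Nat as N
open import Data.Bool using (if_then_else_)
open import Data.Product using (_×_; _,_; proj₁)
open import Relation.Nullary using (¬_)
open import Algebra.Bundles using (CommutativeRing)

-- A field: a commutative ring with 0 ≠ 1 and an inverse operation that is a
-- multiplicative inverse on every non-zero element (its value at 0 is irrelevant).
record Field (c ℓ : Level) : Set (lsuc (c ⊔ ℓ)) where
  field
    commutativeRing : CommutativeRing c ℓ
  open CommutativeRing commutativeRing public
  field
    _⁻¹       : Carrier → Carrier
    ⁻¹-inverse : ∀ x → ¬ (x ≈ 0#) → x * (x ⁻¹) ≈ 1#
    0≉1       : ¬ (0# ≈ 1#)

data Shift : Set where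
  m1 z0 p1 : Shift

shift : Shift → ℕ → ℕ
shift m1 i = i ∸ 1
shift z0 i = i
shift p1 i = suc i

-- r ↦ r + 2
corner : Shift → ℕ
corner m1 = 1
corner z0 = 2
corner p1 = 3

-- Index p of the matrix obtained by deleting index a (1-based): p-th surviving index.
skip : ℕ → ℕ → ℕ
skip a p = if p <ᵇ a then p else suc p

-- The a-th (a ∈ {1,2}) index of {1,…,ℓ+3} not in the block {c,…,c+ℓ}.
remaining : ℕ → ℕ → ℕ → ℕ
remaining c ℓ a = if a <ᵇ c then a else a N.+ ℓ N.+ 1

module FieldDefs {c ℓ′ : Level} (F : Field c ℓ′) where
  open Field F

  -- Matrices are 1-indexed: entry (p , q) for p , q ≥ 1; a size is carried separately.
  Mat : Set c
  Mat = ℕ → ℕ → Carrier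

  sumTo : ℕ → (ℕ → Carrier) → Carrier
  sumTo zero    f = 0#
  sumTo (suc m) f = sumTo m f + f (suc m)

  alt : ℕ → Carrier → Carrier
  alt zero    x = x
  alt (suc t) x = - alt t x

  minor : Mat → ℕ → ℕ → Mat
  minor X a b p q = X (skip a p) (skip b q)

  -- Determinant of the m×m matrix X_{1..m,1..m} (Laplace expansion along row 1).
  det : ℕ → Mat → Carrier
  det zero    X = 1#
  det (suc m) X = sumTo (suc m) (λ q → alt (q ∸ 1) (X 1 q * det m (minor X 1 q)))

  sub : Mat → ℕ → ℕ → Mat
  sub X a b p q = X (a ∸ 1 N.+ p) (b ∸ 1 N.+ q)

  cond : Mat → Mat
  cond X p q = X p q * X (suc p) (suc q) - X (suc p) q * X p (suc q)

  -- steps A t = (A^(n-t) , A^(n-t-1)); division x / d is x * d ⁻¹.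
  steps : Mat → ℕ → Mat × Mat
  steps A zero    = A , cond A
  steps A (suc t) with steps A t
  ... | X , Y = Y , (λ p q → cond Y p q * (X (suc p) (suc q)) ⁻¹)

  -- Dodgson A t = A^(n - t): the matrix after t condensation steps.
  Dodgson : Mat → ℕ → Mat
  Dodgson A t = proj₁ (steps A t)

  -- Dodgson's method on the n×n matrix A produced A^(n),…,A^(k) without
  -- division by zero: for every level m = n - t with k ≤ m ≤ n-2 and every
  -- 1 ≤ p , q ≤ m, the divisor A^(m+2)_{p+1,q+1} is non-zero.
  Succeeds : Mat → ℕ → ℕ → Set ℓ′
  Succeeds A n k = ∀ t p q → 2 N.≤ t → t N.≤ n ∸ k →
    1 N.≤ p → p N.≤ n ∸ t → 1 N.≤ q → q N.≤ n ∸ t →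
    ¬ (Dodgson A (t ∸ 2) (suc p) (suc q) ≈ 0#)

  calA : Mat → ℕ → ℕ → Mat
  calA A i j = sub A (i ∸ 1) (j ∸ 1)

  -- M' for the (ℓ+3)×(ℓ+3) matrix 𝒜 and M with corner (r+2 , s+2):
  -- M'_{a,b} = minor in 𝒜 of the (a,b) entry of M*.
  M′ : Mat → ℕ → Shift → Shift → Mat
  M′ 𝒜 ℓ r s a b =
    det (ℓ N.+ 2) (minor 𝒜 (remaining (corner r) ℓ a) (remaining (corner s) ℓ b))

-- On the levels where Dodgson's method has succeeded, its entries are the connected minors of A
-- (induction, each step being the Desnanot–Jacobi identity for the first/last rows and columns).
-- Hence α = det A_{i+r…i+r+ℓ, j+s…j+s+ℓ}, which is exactly the minor of 𝒜 complementary to the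
-- 2×2 minor M*.  The Desnanot–Jacobi identity for the two rows and two columns of M* then reads
-- det 𝒜 · α = det M′, and α ≠ 0.
-- Desnanot–Jacobi is proved when the complementary minor π is non-zero: moving columns to the
-- front and transposing reduces it to rows and columns 1, 2, where Cramer-style column operations
-- turn X into a block-triangular matrix of determinant π² det X.

module Submission where

open import Defs
open import Data.Nat using (ℕ; _≤_; _∸_)
import Data.Nat as N
open import Relation.Nullary using (¬_)
open import Level using (Level)

open import Data.Nat using (zero; suc; _<_; z≤n; s≤s; _<ᵇ_; _≟_; _<?_)
open import Data.Nat.Properties
  using (≤-refl; ≤-reflexive; ≤-trans; ≤-pred; <-irrefl; <-trans; <-≤-trans; ≮⇒≥; ≤∧≢⇒<; <⇒≱;
         n≤1+n; n<1+n; m≤n⇒m≤1+n; <⇒<ᵇ; <ᵇ⇒<; suc-injective)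
import Data.Nat.Properties as ℕₚ
open import Data.Bool using (T; true; false)
open import Data.Product using (Σ; _×_; _,_; proj₁; proj₂)
open import Data.Empty using (⊥-elim)
open import Relation.Nullary using (yes; no)
open import Relation.Binary.PropositionalEquality as ≡ using (_≡_; _≢_)

skip-< : ∀ {a p} → p < a → skip a p ≡ p
skip-< {a} {p} p<a with p <ᵇ a in eq
... | true  = ≡.refl
... | false = ⊥-elim (≡.subst T eq (<⇒<ᵇ p<a))

skip-≥ : ∀ {a p} → a ≤ p → skip a p ≡ suc p
skip-≥ {a} {p} a≤p with p <ᵇ a in eq
... | true  = ⊥-elim (<⇒≱ (<ᵇ⇒< p a (≡.subst T (≡.sym eq) _)) a≤p)
... | false = ≡.refl

skip-suc : ∀ a p → skip (suc a) (suc p) ≡ suc (skip a p)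
skip-suc a p with p <? a
... | yes p<a = ≡.trans (skip-< (s≤s p<a)) (≡.cong suc (≡.sym (skip-< p<a)))
... | no p≮a  = ≡.trans (skip-≥ (s≤s (≮⇒≥ p≮a))) (≡.cong suc (≡.sym (skip-≥ (≮⇒≥ p≮a))))

skip-skip : ∀ {a b} p → a ≤ b → skip a (skip b p) ≡ skip (suc b) (skip a p)
skip-skip {a} {b} p a≤b with p <? a | p <? b
... | yes p<a | _ = begin
  skip a (skip b p)        ≡⟨ ≡.cong (skip a) (skip-< (<-≤-trans p<a a≤b)) ⟩
  skip a p                 ≡⟨ skip-< p<a ⟩
  p                        ≡⟨ ≡.sym (skip-< (<-≤-trans p<a (m≤n⇒m≤1+n a≤b))) ⟩
  skip (suc b) p           ≡⟨ ≡.cong (skip (suc b)) (≡.sym (skip-< p<a)) ⟩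
  skip (suc b) (skip a p)  ∎
  where open ≡.≡-Reasoning
... | no p≮a | yes p<b = begin
  skip a (skip b p)        ≡⟨ ≡.cong (skip a) (skip-< p<b) ⟩
  skip a p                 ≡⟨ skip-≥ (≮⇒≥ p≮a) ⟩
  suc p                    ≡⟨ ≡.sym (skip-< (s≤s p<b)) ⟩
  skip (suc b) (suc p)     ≡⟨ ≡.cong (skip (suc b)) (≡.sym (skip-≥ (≮⇒≥ p≮a))) ⟩
  skip (suc b) (skip a p)  ∎
  where open ≡.≡-Reasoning
... | no p≮a | no p≮b = begin
  skip a (skip b p)        ≡⟨ ≡.cong (skip a) (skip-≥ (≮⇒≥ p≮b)) ⟩
  skip a (suc p)           ≡⟨ skip-≥ (m≤n⇒m≤1+n (≮⇒≥ p≮a)) ⟩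
  suc (suc p)              ≡⟨ ≡.sym (skip-≥ (s≤s (≮⇒≥ p≮b))) ⟩
  skip (suc b) (suc p)     ≡⟨ ≡.cong (skip (suc b)) (≡.sym (skip-≥ (≮⇒≥ p≮a))) ⟩
  skip (suc b) (skip a p)  ∎
  where open ≡.≡-Reasoning

p≤skip : ∀ a p → p ≤ skip a p
p≤skip a p with p <? a
... | yes p<a = ≤-reflexive (≡.sym (skip-< p<a))
... | no p≮a  = ≤-trans (n≤1+n p) (≤-reflexive (≡.sym (skip-≥ (≮⇒≥ p≮a))))

skip≤suc : ∀ a p → skip a p ≤ suc p
skip≤suc a p with p <? a
... | yes p<a = ≤-trans (≤-reflexive (skip-< p<a)) (n≤1+n p)
... | no p≮a  = ≤-reflexive (skip-≥ (≮⇒≥ p≮a))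

skip≢ : ∀ a p → skip a p ≢ a
skip≢ a p with p <? a
... | yes p<a = λ e → <-irrefl (≡.trans (≡.sym (skip-< p<a)) e) p<a
... | no p≮a  = λ e → <-irrefl (≡.sym (≡.trans (≡.sym (skip-≥ (≮⇒≥ p≮a))) e)) (s≤s (≮⇒≥ p≮a))

skip-injective : ∀ a {p q} → skip a p ≡ skip a q → p ≡ q
skip-injective a {p} {q} e with p <? a | q <? a
... | yes p<a | yes q<a = ≡.trans (≡.sym (skip-< p<a)) (≡.trans e (skip-< q<a))
... | yes p<a | no q≮a  = ⊥-elim (<-irrefl e′ (<-≤-trans p<a (≤-trans (≮⇒≥ q≮a) (n≤1+n q))))
  where e′ = ≡.trans (≡.sym (skip-< p<a)) (≡.trans e (skip-≥ (≮⇒≥ q≮a)))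
... | no p≮a  | yes q<a = ⊥-elim (<-irrefl (≡.sym e′) (<-≤-trans q<a (≤-trans (≮⇒≥ p≮a) (n≤1+n p))))
  where e′ = ≡.trans (≡.sym (skip-≥ (≮⇒≥ p≮a))) (≡.trans e (skip-< q<a))
... | no p≮a  | no q≮a  =
  suc-injective (≡.trans (≡.sym (skip-≥ (≮⇒≥ p≮a))) (≡.trans e (skip-≥ (≮⇒≥ q≮a))))

skip-preimage : ∀ {a q m} → 1 ≤ a → 1 ≤ q → q ≤ suc m → a ≤ suc m → q ≢ a →
                Σ ℕ λ p → skip a p ≡ q × 1 ≤ p × p ≤ m
skip-preimage {a} {q} 1≤a 1≤q q≤1+m a≤1+m q≢a with q <? a
... | yes q<a = q , skip-< q<a , 1≤q , ≤-pred (<-≤-trans q<a a≤1+m)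
skip-preimage {a} {suc p} 1≤a 1≤q (s≤s p≤m) a≤1+m q≢a | no q≮a =
  p , skip-≥ a≤p , ≤-trans 1≤a a≤p , p≤m
  where a≤p = ≤-pred (≤∧≢⇒< (≮⇒≥ q≮a) (λ e → q≢a (≡.sym e)))

skip-range : ∀ a {p m} → 1 ≤ p → p ≤ m → 1 ≤ skip a p × skip a p ≤ suc m
skip-range a 1≤p p≤m = ≤-trans 1≤p (p≤skip a _) , ≤-trans (skip≤suc a _) (s≤s p≤m)

corner-shift : ∀ {a} r → 1 ≤ a → 1 ≤ r → a ∸ 1 N.+ skip 1 r ≡ suc a ∸ 1 N.+ r
corner-shift {suc a} r _ 1≤r = ≡.trans (≡.cong (a N.+_) (skip-≥ 1≤r)) (ℕₚ.+-suc a r)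

suc-≤-∸ : ∀ {p n s} → 1 ≤ p → p ≤ n ∸ suc s → suc p ≤ n ∸ s
suc-≤-∸ {p} {n} {s} 1≤p p≤n∸1+s =
  ℕₚ.m+n≤o⇒m≤o∸n (suc p) (≡.subst (_≤ n) (ℕₚ.+-suc p s) (ℕₚ.m≤o∸n⇒m+n≤o p 1+s≤n p≤n∸1+s))
  where
  1+s≤n : suc s ≤ n
  1+s≤n = ℕₚ.m∸n≢0⇒n<m λ n∸s≡0 → <⇒≱ (≤-trans 1≤p p≤n∸1+s)
            (≤-trans (ℕₚ.∸-monoʳ-≤ n (n≤1+n s)) (≤-reflexive n∸s≡0))

≤-∸-suc : ∀ {p n s} → p ≤ n ∸ suc s → p ≤ n ∸ s
≤-∸-suc {n = n} {s} p≤ = ≤-trans p≤ (ℕₚ.∸-monoʳ-≤ n (n≤1+n s))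

shift-range : ∀ r {i k} → 2 ≤ i → i ≤ k ∸ 1 → 1 ≤ shift r i × shift r i ≤ k
shift-range r {suc zero} (s≤s ()) _
shift-range m1 {suc (suc i)} _ i≤k-1 = s≤s z≤n , ≤-trans (n≤1+n _) (≤-trans i≤k-1 (ℕₚ.m∸n≤m _ 1))
shift-range z0 {suc (suc i)} _ i≤k-1 = s≤s z≤n , ≤-trans i≤k-1 (ℕₚ.m∸n≤m _ 1)
shift-range p1 {suc (suc i)} {suc k} _ i≤k = s≤s z≤n , s≤s i≤k

remaining-range : ∀ r ℓ → let a = remaining (corner r) ℓ 1; b = remaining (corner r) ℓ 2 in
                  1 ≤ a × a < b × b ≤ suc (suc (suc ℓ))
remaining-range m1 ℓ = s≤s z≤n , ≤-refl , ≤-reflexive (≡.cong (λ m → suc (suc m)) (ℕₚ.+-comm ℓ 1))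
remaining-range z0 ℓ = s≤s z≤n , s≤s (s≤s z≤n) , ≤-reflexive (≡.cong (λ m → suc (suc m)) (ℕₚ.+-comm ℓ 1))
remaining-range p1 ℓ = s≤s z≤n , s≤s (s≤s z≤n) , s≤s (s≤s z≤n)

skip-last : ∀ ℓ {x} → x ≤ suc ℓ → skip (suc (ℓ N.+ 1)) x ≡ x
skip-last ℓ x≤1+ℓ = skip-< (s≤s (≤-trans x≤1+ℓ (≤-reflexive (ℕₚ.+-comm 1 ℓ))))

-- Deleting the two remaining rows from rows i-1, …, i+ℓ+1 leaves the rows i+r, …, i+r+ℓ.
skip-remaining : ∀ r {i} ℓ x → 2 ≤ i → 1 ≤ x → x ≤ suc ℓ →
  i ∸ 1 ∸ 1 N.+ skip (remaining (corner r) ℓ 1) (skip (remaining (corner r) ℓ 2 ∸ 1) x) ≡ shift r i ∸ 1 N.+ x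
skip-remaining r {suc zero} ℓ x (s≤s ())
skip-remaining m1 {suc (suc i)} ℓ x _ _ x≤1+ℓ =
  ≡.cong (i N.+_) (≡.trans (≡.cong (skip (suc (ℓ N.+ 1))) (skip-last ℓ x≤1+ℓ)) (skip-last ℓ x≤1+ℓ))
skip-remaining z0 {suc (suc i)} ℓ x _ 1≤x x≤1+ℓ = begin
  i N.+ skip 1 (skip (suc (ℓ N.+ 1)) x) ≡⟨ ≡.cong (λ y → i N.+ skip 1 y) (skip-last ℓ x≤1+ℓ) ⟩
  i N.+ skip 1 x                        ≡⟨ ≡.cong (i N.+_) (skip-≥ 1≤x) ⟩
  i N.+ suc x                           ≡⟨ ℕₚ.+-suc i x ⟩
  suc i N.+ x                           ∎
  where open ≡.≡-Reasoning
skip-remaining p1 {suc (suc i)} ℓ x _ 1≤x _ = begin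
  i N.+ skip 1 (skip 1 x) ≡⟨ ≡.cong (λ y → i N.+ skip 1 y) (skip-≥ 1≤x) ⟩
  i N.+ skip 1 (suc x)    ≡⟨ ≡.cong (i N.+_) (skip-≥ (s≤s z≤n)) ⟩
  i N.+ suc (suc x)       ≡⟨ ℕₚ.+-suc i (suc x) ⟩
  suc (i N.+ suc x)       ≡⟨ ≡.cong suc (ℕₚ.+-suc i x) ⟩
  suc (suc i) N.+ x       ∎
  where open ≡.≡-Reasoning

module Condensation {c ℓ′ : Level} (F : Field c ℓ′) where
  open Field F hiding (zero)
  open FieldDefs F
  open import Algebra.Properties.Ring ring
    using (x[y-z]≈xy-xz; -0#≈0#; -‿+-comm; +-inverseʳ-unique; -‿distribˡ-*; -‿distribʳ-*; -‿involutive; -1*x≈-x)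
  open import Algebra.Properties.CommutativeSemigroup +-commutativeSemigroup using (interchange)
  open import Algebra.Properties.CommutativeSemigroup *-commutativeSemigroup using (x∙yz≈y∙xz)
  open import Relation.Binary.Reasoning.Setoid setoid

  -- Finite sums and signs

  sumTo-cong : ∀ m {f g} → (∀ q → 1 ≤ q → q ≤ m → f q ≈ g q) → sumTo m f ≈ sumTo m g
  sumTo-cong zero    f≈g = refl
  sumTo-cong (suc m) f≈g =
    +-cong (sumTo-cong m (λ q 1≤q q≤m → f≈g q 1≤q (m≤n⇒m≤1+n q≤m))) (f≈g (suc m) (s≤s z≤n) ≤-refl)

  sumTo-zero : ∀ m {f} → (∀ q → 1 ≤ q → q ≤ m → f q ≈ 0#) → sumTo m f ≈ 0#
  sumTo-zero zero    f≈0 = refl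
  sumTo-zero (suc m) f≈0 = begin
    sumTo m _ + _
      ≈⟨ +-cong (sumTo-zero m (λ q 1≤q q≤m → f≈0 q 1≤q (m≤n⇒m≤1+n q≤m))) (f≈0 (suc m) (s≤s z≤n) ≤-refl) ⟩
    0# + 0#
      ≈⟨ +-identityʳ 0# ⟩
    0# ∎

  sumTo-+ : ∀ m f g → sumTo m (λ q → f q + g q) ≈ sumTo m f + sumTo m g
  sumTo-+ zero    f g = sym (+-identityˡ 0#)
  sumTo-+ (suc m) f g = trans (+-congʳ (sumTo-+ m f g)) (interchange _ _ _ _)

  sumTo-*ˡ : ∀ m x f → x * sumTo m f ≈ sumTo m (λ q → x * f q)
  sumTo-*ˡ zero    x f = zeroʳ x
  sumTo-*ˡ (suc m) x f = trans (distribˡ _ _ _) (+-congʳ (sumTo-*ˡ m x f))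

  sumTo-neg : ∀ m f → - sumTo m f ≈ sumTo m (λ q → - f q)
  sumTo-neg zero    f = -0#≈0#
  sumTo-neg (suc m) f = trans (sym (-‿+-comm _ _)) (+-congʳ (sumTo-neg m f))

  sumTo-unfoldˡ : ∀ m f → sumTo (suc m) f ≈ f 1 + sumTo m (λ q → f (suc q))
  sumTo-unfoldˡ zero    f = trans (+-identityˡ _) (sym (+-identityʳ _))
  sumTo-unfoldˡ (suc m) f = trans (+-congʳ (sumTo-unfoldˡ m f)) (+-assoc _ _ _)

  sumTo-swap : ∀ m n (f : ℕ → ℕ → Carrier) →
               sumTo m (λ a → sumTo n (f a)) ≈ sumTo n (λ b → sumTo m (λ a → f a b))
  sumTo-swap zero    n f = sym (sumTo-zero n (λ _ _ _ → refl))
  sumTo-swap (suc m) n f = trans (+-congʳ (sumTo-swap m n f)) (sym (sumTo-+ n _ _))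

  alt-cong : ∀ n {x y} → x ≈ y → alt n x ≈ alt n y
  alt-cong zero    x≈y = x≈y
  alt-cong (suc n) x≈y = -‿cong (alt-cong n x≈y)

  alt-*ˡ : ∀ n x y → alt n x * y ≈ alt n (x * y)
  alt-*ˡ zero    x y = refl
  alt-*ˡ (suc n) x y = trans (sym (-‿distribˡ-* _ _)) (-‿cong (alt-*ˡ n x y))

  alt-*ʳ : ∀ n x y → x * alt n y ≈ alt n (x * y)
  alt-*ʳ zero    x y = refl
  alt-*ʳ (suc n) x y = trans (sym (-‿distribʳ-* _ _)) (-‿cong (alt-*ʳ n x y))

  alt-+ : ∀ n x y → alt n (x + y) ≈ alt n x + alt n y
  alt-+ zero    x y = refl
  alt-+ (suc n) x y = trans (-‿cong (alt-+ n x y)) (sym (-‿+-comm _ _))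

  alt-neg : ∀ n x → alt n (- x) ≈ - alt n x
  alt-neg zero    x = refl
  alt-neg (suc n) x = -‿cong (alt-neg n x)

  alt-zero : ∀ n → alt n 0# ≈ 0#
  alt-zero zero    = refl
  alt-zero (suc n) = trans (-‿cong (alt-zero n)) -0#≈0#

  alt-alt : ∀ m n x → alt m (alt n x) ≈ alt (m N.+ n) x
  alt-alt zero    n x = refl
  alt-alt (suc m) n x = -‿cong (alt-alt m n x)

  alt-injective : ∀ n {x y} → alt n x ≈ alt n y → x ≈ y
  alt-injective zero    e = e
  alt-injective (suc n) e =
    alt-injective n (trans (sym (-‿involutive _)) (trans (-‿cong e) (-‿involutive _)))

  alt-*-alt : ∀ i j x y → alt i x * alt j y ≈ alt (i N.+ j) (x * y)
  alt-*-alt i j x y = trans (alt-*ˡ i x _) (trans (alt-cong i (alt-*ʳ j x y)) (alt-alt i j _))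

  alt-‿- : ∀ n x y → alt n x - alt n y ≈ alt n (x - y)
  alt-‿- n x y = sym (trans (alt-+ n x (- y)) (+-congˡ (alt-neg n y)))

  alt-swap : ∀ m n x y z → alt (suc m) (x * alt n (y * z)) ≈ alt (suc n) (y * alt m (x * z))
  alt-swap m n x y z = begin
    alt (suc m) (x * alt n (y * z))   ≈⟨ alt-cong (suc m) (alt-*ʳ n x _) ⟩
    alt (suc m) (alt n (x * (y * z))) ≈⟨ alt-alt (suc m) n _ ⟩
    alt (suc m N.+ n) (x * (y * z))   ≡⟨ ≡.cong (λ e → alt (suc e) (x * (y * z))) (ℕₚ.+-comm m n) ⟩
    alt (suc n N.+ m) (x * (y * z))   ≈⟨ alt-cong (suc n N.+ m) (x∙yz≈y∙xz x y z) ⟩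
    alt (suc n N.+ m) (y * (x * z))   ≈⟨ sym (alt-alt (suc n) m _) ⟩
    alt (suc n) (alt m (y * (x * z))) ≈⟨ sym (alt-cong (suc n) (alt-*ʳ m y _)) ⟩
    alt (suc n) (y * alt m (x * z))   ∎

  sumTo-alt : ∀ n m f → alt n (sumTo m f) ≈ sumTo m (λ q → alt n (f q))
  sumTo-alt zero    m f = refl
  sumTo-alt (suc n) m f = trans (-‿cong (sumTo-alt n m f)) (sumTo-neg m _)

  -- Multilinearity and alternation of det

  det-cong-on : ∀ m X Y → (∀ p q → 1 ≤ p → p ≤ m → 1 ≤ q → q ≤ m → X p q ≈ Y p q) → det m X ≈ det m Y
  det-cong-on zero    X Y X≈Y = refl
  det-cong-on (suc m) X Y X≈Y = sumTo-cong (suc m) λ t 1≤t t≤1+m → alt-cong (t ∸ 1)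
    (*-cong (X≈Y 1 t (s≤s z≤n) (s≤s z≤n) 1≤t t≤1+m)
            (det-cong-on m (minor X 1 t) (minor Y 1 t) λ p q 1≤p p≤m 1≤q q≤m →
              let p₁ , p₂ = skip-range 1 1≤p p≤m
                  q₁ , q₂ = skip-range t 1≤q q≤m
              in X≈Y _ _ p₁ p₂ q₁ q₂))

  det-cong : ∀ m X Y → (∀ p q → X p q ≈ Y p q) → det m X ≈ det m Y
  det-cong m X Y X≈Y = det-cong-on m X Y (λ p q _ _ _ _ → X≈Y p q)

  det-1 : ∀ X → det 1 X ≈ X 1 1
  det-1 X = trans (+-identityˡ _) (*-identityʳ _)

  det-2 : ∀ X → det 2 X ≈ X 1 1 * X 2 2 - X 1 2 * X 2 1
  det-2 X = +-cong (trans (+-identityˡ _) (*-congˡ (det-1 (minor X 1 1)))) (-‿cong (*-congˡ (det-1 (minor X 1 2))))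

  det-linear-col : ∀ k Z X Y c l → 1 ≤ c → c ≤ k →
    (∀ p q → q ≢ c → Z p q ≈ X p q) → (∀ p q → q ≢ c → Z p q ≈ Y p q) →
    (∀ p → Z p c ≈ l * X p c + Y p c) → det k Z ≈ l * det k X + det k Y
  det-linear-col zero Z X Y c l 1≤c c≤0 _ _ _ = ⊥-elim (<⇒≱ 1≤c c≤0)
  det-linear-col (suc k) Z X Y c l 1≤c c≤k Z≈X Z≈Y Zc = begin
    sumTo (suc k) (term Z)
      ≈⟨ sumTo-cong (suc k) split ⟩
    sumTo (suc k) (λ t → l * term X t + term Y t)
      ≈⟨ sumTo-+ (suc k) _ _ ⟩
    sumTo (suc k) (λ t → l * term X t) + det (suc k) Y
      ≈⟨ +-congʳ (sym (sumTo-*ˡ (suc k) l _)) ⟩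
    l * det (suc k) X + det (suc k) Y ∎
    where
    term : Mat → ℕ → Carrier
    term W t = alt (t ∸ 1) (W 1 t * det k (minor W 1 t))

    expansion : ∀ t → 1 ≤ t → t ≤ suc k →
      Z 1 t * det k (minor Z 1 t) ≈ l * (X 1 t * det k (minor X 1 t)) + Y 1 t * det k (minor Y 1 t)
    expansion t 1≤t t≤1+k with t ≟ c
    ... | yes ≡.refl = begin
      Z 1 t * det k (minor Z 1 t)
        ≈⟨ *-congʳ (Zc 1) ⟩
      (l * X 1 t + Y 1 t) * det k (minor Z 1 t)
        ≈⟨ distribʳ _ _ _ ⟩
      (l * X 1 t) * det k (minor Z 1 t) + Y 1 t * det k (minor Z 1 t)
        ≈⟨ +-cong (trans (*-assoc _ _ _) (*-congˡ (*-congˡ (det-cong k _ _ λ p q → Z≈X _ _ (skip≢ t q)))))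
                  (*-congˡ (det-cong k _ _ λ p q → Z≈Y _ _ (skip≢ t q))) ⟩
      l * (X 1 t * det k (minor X 1 t)) + Y 1 t * det k (minor Y 1 t) ∎
    ... | no t≢c = begin
      Z 1 t * det k (minor Z 1 t)
        ≈⟨ *-congˡ minor-linear ⟩
      Z 1 t * (l * det k (minor X 1 t) + det k (minor Y 1 t))
        ≈⟨ distribˡ _ _ _ ⟩
      Z 1 t * (l * det k (minor X 1 t)) + Z 1 t * det k (minor Y 1 t)
        ≈⟨ +-cong (trans (x∙yz≈y∙xz _ _ _) (*-congˡ (*-congʳ (Z≈X 1 t t≢c)))) (*-congʳ (Z≈Y 1 t t≢c)) ⟩
      l * (X 1 t * det k (minor X 1 t)) + Y 1 t * det k (minor Y 1 t) ∎
      where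
      c′-prop = skip-preimage 1≤t 1≤c c≤k t≤1+k (λ e → t≢c (≡.sym e))
      c′ = proj₁ c′-prop
      skip-c′ : skip t c′ ≡ c
      skip-c′ = proj₁ (proj₂ c′-prop)
      off : ∀ q → q ≢ c′ → skip t q ≢ c
      off q q≢c′ e = q≢c′ (skip-injective t (≡.trans e (≡.sym skip-c′)))
      minor-linear : det k (minor Z 1 t) ≈ l * det k (minor X 1 t) + det k (minor Y 1 t)
      minor-linear = det-linear-col k (minor Z 1 t) (minor X 1 t) (minor Y 1 t) c′ l
        (proj₁ (proj₂ (proj₂ c′-prop))) (proj₂ (proj₂ (proj₂ c′-prop)))
        (λ p q q≢c′ → Z≈X _ _ (off q q≢c′)) (λ p q q≢c′ → Z≈Y _ _ (off q q≢c′))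
        (λ p → begin
          Z (skip 1 p) (skip t c′)                          ≡⟨ ≡.cong (Z _) skip-c′ ⟩
          Z (skip 1 p) c                                    ≈⟨ Zc _ ⟩
          l * X (skip 1 p) c + Y (skip 1 p) c
            ≡⟨ ≡.sym (≡.cong₂ (λ x y → l * x + y) (≡.cong (X _) skip-c′) (≡.cong (Y _) skip-c′)) ⟩
          l * X (skip 1 p) (skip t c′) + Y (skip 1 p) (skip t c′) ∎)

    split : ∀ t → 1 ≤ t → t ≤ suc k → term Z t ≈ l * term X t + term Y t
    split t 1≤t t≤1+k = trans (alt-cong (t ∸ 1) (expansion t 1≤t t≤1+k))
      (trans (alt-+ (t ∸ 1) _ _) (+-congʳ (sym (alt-*ʳ (t ∸ 1) _ _))))

  setCol : Mat → ℕ → (ℕ → Carrier) → Mat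
  setCol X c v p q with q ≟ c
  ... | yes _ = v p
  ... | no  _ = X p q

  setCol-≡ : ∀ X c v p → setCol X c v p c ≈ v p
  setCol-≡ X c v p with c ≟ c
  ... | yes _   = refl
  ... | no  c≢c = ⊥-elim (c≢c ≡.refl)

  setCol-≢ : ∀ X c v p q → q ≢ c → setCol X c v p q ≈ X p q
  setCol-≢ X c v p q q≢c with q ≟ c
  ... | yes q≡c = ⊥-elim (q≢c q≡c)
  ... | no  _   = refl

  det-zero-col : ∀ k Z c → 1 ≤ c → c ≤ k → (∀ p → Z p c ≈ 0#) → det k Z ≈ 0#
  det-zero-col k Z c 1≤c c≤k Zc≈0 = begin
    det k Z                  ≈⟨ det-linear-col k Z Z Z c (- 1#) 1≤c c≤k (λ _ _ _ → refl) (λ _ _ _ → refl) Zc ⟩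
    - 1# * det k Z + det k Z ≈⟨ +-congʳ (-1*x≈-x _) ⟩
    - det k Z + det k Z      ≈⟨ -‿inverseˡ _ ⟩
    0#                       ∎
    where
    Zc : ∀ p → Z p c ≈ - 1# * Z p c + Z p c
    Zc p = trans (Zc≈0 p) (sym (trans (+-cong (*-congˡ (Zc≈0 p)) (Zc≈0 p)) (trans (+-identityʳ _) (zeroʳ _))))

  sumTo-cancelling-pair : ∀ m f c → 1 ≤ c → suc c ≤ m →
    (∀ t → 1 ≤ t → t ≤ m → t ≢ c → t ≢ suc c → f t ≈ 0#) → f c + f (suc c) ≈ 0# → sumTo m f ≈ 0#
  sumTo-cancelling-pair (suc m) f (suc c) _ (s≤s c<m) vanish pair with suc c ≟ m
  ... | yes ≡.refl = begin
    (sumTo c f + f (suc c)) + f (suc (suc c)) ≈⟨ +-assoc _ _ _ ⟩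
    sumTo c f + (f (suc c) + f (suc (suc c))) ≈⟨ +-cong (sumTo-zero c below) pair ⟩
    0# + 0#                                   ≈⟨ +-identityʳ 0# ⟩
    0#                                        ∎
    where
    below : ∀ t → 1 ≤ t → t ≤ c → f t ≈ 0#
    below t 1≤t t≤c = vanish t 1≤t (m≤n⇒m≤1+n (m≤n⇒m≤1+n t≤c))
      (λ e → <-irrefl e (s≤s t≤c)) (λ e → <-irrefl e (s≤s (m≤n⇒m≤1+n t≤c)))
  ... | no 1+c≢m = begin
    sumTo m f + f (suc m) ≈⟨ +-cong (sumTo-cancelling-pair m f (suc c) (s≤s z≤n) 2+c≤m vanish′ pair) last ⟩
    0# + 0#               ≈⟨ +-identityʳ 0# ⟩
    0#                    ∎
    where
    2+c≤m = ≤∧≢⇒< c<m 1+c≢m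
    vanish′ : ∀ t → 1 ≤ t → t ≤ m → t ≢ suc c → t ≢ suc (suc c) → f t ≈ 0#
    vanish′ t 1≤t t≤m = vanish t 1≤t (m≤n⇒m≤1+n t≤m)
    last = vanish (suc m) (s≤s z≤n) ≤-refl (λ e → <-irrefl (≡.sym e) (<-trans (n<1+n (suc c)) (s≤s 2+c≤m)))
                                           (λ e → <-irrefl (≡.sym e) (s≤s 2+c≤m))

  -- In the row-1 expansion the terms of columns c and c+1 cancel; every other minor still has
  -- two equal adjacent columns.
  det-equal-adjacent-cols : ∀ k Y c → 1 ≤ c → suc c ≤ k → (∀ p → Y p c ≈ Y p (suc c)) → det k Y ≈ 0#
  det-equal-adjacent-cols (suc k) Y (suc c) _ 2+c≤1+k Yc≈Yc′ =
    sumTo-cancelling-pair (suc k) term (suc c) (s≤s z≤n) 2+c≤1+k vanish pair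
    where
    term : ℕ → Carrier
    term t = alt (t ∸ 1) (Y 1 t * det k (minor Y 1 t))

    minors-equal : ∀ p q → minor Y 1 (suc c) p q ≈ minor Y 1 (suc (suc c)) p q
    minors-equal p q with q <? suc c | q ≟ suc c
    ... | yes q<c | _ = reflexive (≡.cong (Y _) (≡.trans (skip-< q<c) (≡.sym (skip-< (m≤n⇒m≤1+n q<c)))))
    ... | no _ | yes ≡.refl = begin
      Y _ (skip (suc c) (suc c))       ≡⟨ ≡.cong (Y _) (skip-≥ ≤-refl) ⟩
      Y _ (suc (suc c))                ≈⟨ sym (Yc≈Yc′ _) ⟩
      Y _ (suc c)                      ≡⟨ ≡.cong (Y _) (≡.sym (skip-< (n<1+n _))) ⟩
      Y _ (skip (suc (suc c)) (suc c)) ∎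
    ... | no q≮c | no q≢c = reflexive (≡.cong (Y _) (≡.trans (skip-≥ (≮⇒≥ q≮c))
                                 (≡.sym (skip-≥ (≤∧≢⇒< (≮⇒≥ q≮c) (λ e → q≢c (≡.sym e)))))))

    pair : term (suc c) + term (suc (suc c)) ≈ 0#
    pair = trans (+-congˡ (-‿cong (alt-cong c (*-cong (sym (Yc≈Yc′ 1)) (det-cong k _ _ λ p q → sym (minors-equal p q))))))
      (-‿inverseʳ _)

    vanishing-minor : ∀ t → 1 ≤ t → t ≤ suc k → t ≢ suc c → t ≢ suc (suc c) → det k (minor Y 1 t) ≈ 0#
    vanishing-minor t 1≤t t≤1+k t≢c t≢c′ with t <? suc c
    ... | yes t<1+c = det-equal-adjacent-cols k (minor Y 1 t) c (≤-trans 1≤t (≤-pred t<1+c)) (≤-pred 2+c≤1+k)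
      λ p → begin
        Y _ (skip t c)             ≡⟨ ≡.cong (Y _) (skip-≥ (≤-pred t<1+c)) ⟩
        Y _ (suc c)                ≈⟨ Yc≈Yc′ _ ⟩
        Y _ (suc (suc c))          ≡⟨ ≡.cong (Y _) (≡.sym (skip-≥ (m≤n⇒m≤1+n (≤-pred t<1+c)))) ⟩
        Y _ (skip t (suc c))       ∎
    ... | no t≮1+c = det-equal-adjacent-cols k (minor Y 1 t) (suc c) (s≤s z≤n) (≤-pred (<-≤-trans c′<t t≤1+k))
      λ p → begin
        Y _ (skip t (suc c))       ≡⟨ ≡.cong (Y _) (skip-< (<-trans (n<1+n _) c′<t)) ⟩
        Y _ (suc c)                ≈⟨ Yc≈Yc′ _ ⟩
        Y _ (suc (suc c))          ≡⟨ ≡.cong (Y _) (≡.sym (skip-< c′<t)) ⟩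
        Y _ (skip t (suc (suc c))) ∎
      where
      c′<t : suc (suc c) < t
      c′<t = ≤∧≢⇒< (≤∧≢⇒< (≮⇒≥ t≮1+c) (λ e → t≢c (≡.sym e))) (λ e → t≢c′ (≡.sym e))

    vanish : ∀ t → 1 ≤ t → t ≤ suc k → t ≢ suc c → t ≢ suc (suc c) → term t ≈ 0#
    vanish t 1≤t t≤1+k t≢c t≢c′ =
      trans (alt-cong (t ∸ 1) (trans (*-congˡ (vanishing-minor t 1≤t t≤1+k t≢c t≢c′)) (zeroʳ _))) (alt-zero (t ∸ 1))

  det-additive-col : ∀ k Z X Y c → 1 ≤ c → c ≤ k →
    (∀ p q → q ≢ c → Z p q ≈ X p q) → (∀ p q → q ≢ c → Z p q ≈ Y p q) →
    (∀ p → Z p c ≈ X p c + Y p c) → det k Z ≈ det k X + det k Y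
  det-additive-col k Z X Y c 1≤c c≤k Z≈X Z≈Y Zc =
    trans (det-linear-col k Z X Y c 1# 1≤c c≤k Z≈X Z≈Y λ p → trans (Zc p) (+-congʳ (sym (*-identityˡ _))))
          (+-congʳ (*-identityˡ _))

  withCols : Mat → ℕ → (ℕ → Carrier) → (ℕ → Carrier) → Mat
  withCols Y c u v p q with q ≟ c | q ≟ suc c
  ... | yes _ | _     = u p
  ... | no _  | yes _ = v p
  ... | no _  | no _  = Y p q

  module _ (Y : Mat) (c : ℕ) (p : ℕ) where

    withCols-elim : ∀ u v q (R : Carrier → Set ℓ′) → (q ≡ c → R (u p)) → (q ≡ suc c → R (v p)) →
                    (q ≢ c → q ≢ suc c → R (Y p q)) → R (withCols Y c u v p q)
    withCols-elim u v q R at₁ at₂ off with q ≟ c | q ≟ suc c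
    ... | yes q≡c | _         = at₁ q≡c
    ... | no q≢c  | yes q≡1+c = at₂ q≡1+c
    ... | no q≢c  | no q≢1+c  = off q≢c q≢1+c

    withCols-₁ : ∀ u v → withCols Y c u v p c ≈ u p
    withCols-₁ u v = withCols-elim u v c (_≈ u p) (λ _ → refl)
      (λ e → ⊥-elim (<-irrefl e (n<1+n c))) (λ c≢c → ⊥-elim (c≢c ≡.refl))

    withCols-₂ : ∀ u v → withCols Y c u v p (suc c) ≈ v p
    withCols-₂ u v = withCols-elim u v (suc c) (_≈ v p) (λ e → ⊥-elim (<-irrefl (≡.sym e) (n<1+n c)))
      (λ _ → refl) (λ _ c≢c → ⊥-elim (c≢c ≡.refl))

    withCols-off : ∀ u v q → q ≢ c → q ≢ suc c → withCols Y c u v p q ≈ Y p q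
    withCols-off u v q q≢c q≢1+c = withCols-elim u v q (_≈ Y p q)
      (λ e → ⊥-elim (q≢c e)) (λ e → ⊥-elim (q≢1+c e)) (λ _ _ → refl)

    withCols-agree₁ : ∀ u u′ v q → q ≢ c → withCols Y c u v p q ≈ withCols Y c u′ v p q
    withCols-agree₁ u u′ v q q≢c = withCols-elim u v q (_≈ withCols Y c u′ v p q) (λ e → ⊥-elim (q≢c e))
      (λ { ≡.refl → sym (withCols-₂ u′ v) }) (λ q≢c q≢1+c → sym (withCols-off u′ v q q≢c q≢1+c))

    withCols-agree₂ : ∀ u v v′ q → q ≢ suc c → withCols Y c u v p q ≈ withCols Y c u v′ p q
    withCols-agree₂ u v v′ q q≢1+c = withCols-elim u v q (_≈ withCols Y c u v′ p q)
      (λ { ≡.refl → sym (withCols-₁ u v′) }) (λ e → ⊥-elim (q≢1+c e))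
      (λ q≢c q≢1+c → sym (withCols-off u v′ q q≢c q≢1+c))

  det-swap-adjacent-cols : ∀ k Y Y′ c → 1 ≤ c → suc c ≤ k →
    (∀ p q → q ≢ c → q ≢ suc c → Y′ p q ≈ Y p q) →
    (∀ p → Y′ p c ≈ Y p (suc c)) → (∀ p → Y′ p (suc c) ≈ Y p c) → det k Y′ ≈ - det k Y
  det-swap-adjacent-cols k Y Y′ c 1≤c 1+c≤k off at₁ at₂ = +-inverseʳ-unique _ _ (begin
    det k Y + det k Y′
      ≈⟨ sym (+-cong (trans (+-cong (zero-if-equal x) straight) (+-identityˡ _))
                     (trans (+-cong swapped (zero-if-equal y)) (+-identityʳ _))) ⟩
    (det k (W x x) + det k (W x y)) + (det k (W y x) + det k (W y y))
      ≈⟨ sym (+-cong (split₂ x) (split₂ y)) ⟩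
    det k (W x s) + det k (W y s)
      ≈⟨ sym split₁ ⟩
    det k (W s s)
      ≈⟨ zero-if-equal s ⟩
    0# ∎)
    where
    x y s : ℕ → Carrier
    x p = Y p c
    y p = Y p (suc c)
    s p = x p + y p
    W = withCols Y c
    c≤k = ≤-trans (n≤1+n c) 1+c≤k

    zero-if-equal : ∀ u → det k (W u u) ≈ 0#
    zero-if-equal u = det-equal-adjacent-cols k (W u u) c 1≤c 1+c≤k
      λ p → trans (withCols-₁ Y c p u u) (sym (withCols-₂ Y c p u u))

    split₁ : det k (W s s) ≈ det k (W x s) + det k (W y s)
    split₁ = det-additive-col k _ _ _ c 1≤c c≤k
      (λ p → withCols-agree₁ Y c p s x s) (λ p → withCols-agree₁ Y c p s y s)
      λ p → trans (withCols-₁ Y c p s s) (sym (+-cong (withCols-₁ Y c p x s) (withCols-₁ Y c p y s)))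

    split₂ : ∀ u → det k (W u s) ≈ det k (W u x) + det k (W u y)
    split₂ u = det-additive-col k _ _ _ (suc c) (s≤s z≤n) 1+c≤k
      (λ p → withCols-agree₂ Y c p u s x) (λ p → withCols-agree₂ Y c p u s y)
      λ p → trans (withCols-₂ Y c p u s) (sym (+-cong (withCols-₂ Y c p u x) (withCols-₂ Y c p u y)))

    straight : det k (W x y) ≈ det k Y
    straight = det-cong k _ _ λ p q → withCols-elim Y c p x y q (_≈ Y p q)
      (λ { ≡.refl → refl }) (λ { ≡.refl → refl }) (λ _ _ → refl)

    swapped : det k (W y x) ≈ det k Y′
    swapped = det-cong k _ _ λ p q → withCols-elim Y c p y x q (_≈ Y′ p q)
      (λ { ≡.refl → sym (at₁ p) }) (λ { ≡.refl → sym (at₂ p) }) (λ q≢c q≢1+c → sym (off p q q≢c q≢1+c))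

  det-equal-cols : ∀ k Y a b → 1 ≤ a → a < b → b ≤ k → (∀ p → Y p a ≈ Y p b) → det k Y ≈ 0#
  det-equal-cols k Y a (suc b) 1≤a (s≤s a≤b) 1+b≤k Ya≈Yb with a ≟ b
  ... | yes ≡.refl = det-equal-adjacent-cols k Y a 1≤a 1+b≤k Ya≈Yb
  ... | no a≢b = begin
    det k Y       ≈⟨ sym (-‿involutive _) ⟩
    - - det k Y   ≈⟨ -‿cong (sym swap) ⟩
    - det k Y′    ≈⟨ -‿cong (det-equal-cols k Y′ a b 1≤a a<b (≤-trans (n≤1+n b) 1+b≤k) Y′a≈Y′b) ⟩
    - 0#          ≈⟨ -0#≈0# ⟩
    0#            ∎
    where
    a<b = ≤∧≢⇒< a≤b a≢b
    Y′ = withCols Y b (λ p → Y p (suc b)) (λ p → Y p b)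
    swap : det k Y′ ≈ - det k Y
    swap = det-swap-adjacent-cols k Y Y′ b (≤-trans 1≤a a≤b) 1+b≤k
      (λ p → withCols-off Y b p _ _) (λ p → withCols-₁ Y b p _ _) (λ p → withCols-₂ Y b p _ _)
    Y′a≈Y′b : ∀ p → Y′ p a ≈ Y′ p b
    Y′a≈Y′b p = trans (withCols-off Y b p _ _ a (λ e → <-irrefl e a<b) (λ e → <-irrefl e (<-trans a<b (n<1+n b))))
                      (trans (Ya≈Yb p) (sym (withCols-₁ Y b p _ _)))

  det-expand-col₁ : ∀ k X → det (suc k) X ≈ sumTo (suc k) (λ p → alt (p ∸ 1) (X p 1 * det k (minor X p 1)))
  det-expand-col₁ zero    X = refl
  det-expand-col₁ (suc k) X = begin
    det (suc (suc k)) X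
      ≈⟨ sumTo-unfoldˡ (suc k) _ ⟩
    head + sumTo (suc k) (λ t → alt t (X 1 (suc t) * det (suc k) (minor X 1 (suc t))))
      ≈⟨ +-congˡ (sumTo-cong (suc k) by-row) ⟩
    head + sumTo (suc k) (λ t → sumTo (suc k) (G t))
      ≈⟨ +-congˡ (sumTo-swap (suc k) (suc k) G) ⟩
    head + sumTo (suc k) (λ p → sumTo (suc k) (λ t → G t p))
      ≈⟨ +-congˡ (sumTo-cong (suc k) by-col) ⟩
    head + sumTo (suc k) (λ p → alt p (X (suc p) 1 * det (suc k) (minor X (suc p) 1)))
      ≈⟨ sym (sumTo-unfoldˡ (suc k) _) ⟩
    sumTo (suc (suc k)) (λ p → alt (p ∸ 1) (X p 1 * det (suc k) (minor X p 1))) ∎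
    where
    head = alt 0 (X 1 1 * det (suc k) (minor X 1 1))
    -- both row-1 and column-1 expansions become the double sum of the G t p
    G : ℕ → ℕ → Carrier
    G t p = alt t (X 1 (suc t) * alt (p ∸ 1) (X (suc p) 1 * det k (minor (minor X 1 (suc t)) p 1)))

    by-row : ∀ t → 1 ≤ t → t ≤ suc k →
      alt t (X 1 (suc t) * det (suc k) (minor X 1 (suc t))) ≈ sumTo (suc k) (G t)
    by-row t 1≤t _ = begin
      alt t (X 1 (suc t) * det (suc k) (minor X 1 (suc t)))
        ≈⟨ alt-cong t (*-congˡ (det-expand-col₁ k (minor X 1 (suc t)))) ⟩
      alt t (X 1 (suc t) * sumTo (suc k) _)
        ≈⟨ alt-cong t (sumTo-*ˡ (suc k) _ _) ⟩
      alt t (sumTo (suc k) _)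
        ≈⟨ sumTo-alt t (suc k) _ ⟩
      sumTo (suc k) _
        ≈⟨ sumTo-cong (suc k) (λ p 1≤p _ → alt-cong t (*-congˡ (alt-cong (p ∸ 1) (*-congʳ
             (reflexive (≡.cong₂ X (skip-≥ 1≤p) (skip-< (s≤s 1≤t)))))))) ⟩
      sumTo (suc k) (G t) ∎

    by-col : ∀ p → 1 ≤ p → p ≤ suc k →
      sumTo (suc k) (λ t → G t p) ≈ alt p (X (suc p) 1 * det (suc k) (minor X (suc p) 1))
    by-col (suc p) _ _ = sym (begin
      alt (suc p) (X (suc (suc p)) 1 * det (suc k) (minor X (suc (suc p)) 1))
        ≈⟨ alt-cong (suc p) (sumTo-*ˡ (suc k) _ _) ⟩
      alt (suc p) (sumTo (suc k) _)
        ≈⟨ sumTo-alt (suc p) (suc k) _ ⟩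
      sumTo (suc k) _
        ≈⟨ sumTo-cong (suc k) term ⟩
      sumTo (suc k) (λ t → G t (suc p)) ∎)
      where
      term : ∀ t → 1 ≤ t → t ≤ suc k →
        alt (suc p) (X (suc (suc p)) 1 * alt (t ∸ 1)
          (minor X (suc (suc p)) 1 1 t * det k (minor (minor X (suc (suc p)) 1) 1 t))) ≈ G t (suc p)
      term (suc t) _ _ = trans (alt-cong (suc p) (*-congˡ (alt-cong t (*-congˡ minors)))) (alt-swap p t _ _ _)
        where
        minors : det k (minor (minor X (suc (suc p)) 1) 1 (suc t)) ≈ det k (minor (minor X 1 (suc (suc t))) (suc p) 1)
        minors = det-cong k _ _ λ i j →
          reflexive (≡.cong₂ X (≡.sym (skip-skip i (s≤s z≤n))) (skip-skip j (s≤s z≤n)))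

  transpose : Mat → Mat
  transpose X p q = X q p

  det-transpose : ∀ k X → det k (transpose X) ≈ det k X
  det-transpose zero    X = refl
  det-transpose (suc k) X =
    trans (sumTo-cong (suc k) λ t _ _ → alt-cong (t ∸ 1) (*-congˡ (det-transpose k (minor X t 1))))
          (sym (det-expand-col₁ k X))

  det-equal-rows : ∀ k Y a b → 1 ≤ a → a < b → b ≤ k → (∀ q → Y a q ≈ Y b q) → det k Y ≈ 0#
  det-equal-rows k Y a b 1≤a a<b b≤k Ya≈Yb =
    trans (sym (det-transpose k Y)) (det-equal-cols k (transpose Y) a b 1≤a a<b b≤k Ya≈Yb)

  x-[y+z]≈-z+[x-y] : ∀ x y z → x - (y + z) ≈ - z + (x - y)
  x-[y+z]≈-z+[x-y] x y z = begin
    x - (y + z)        ≈⟨ +-congˡ (sym (-‿+-comm _ _)) ⟩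
    x + (- y + - z)    ≈⟨ sym (+-assoc _ _ _) ⟩
    (x - y) + - z      ≈⟨ +-comm _ _ ⟩
    - z + (x - y)      ∎

  det-col-operation : ∀ m k Y Z c (κ : ℕ → ℕ) (μ : ℕ → Carrier) π → 1 ≤ c → c ≤ k →
    (∀ s → 1 ≤ s → s ≤ m → 1 ≤ κ s × κ s ≤ k × κ s ≢ c) →
    (∀ p q → q ≢ c → Z p q ≈ Y p q) →
    (∀ p → Z p c ≈ π * Y p c - sumTo m (λ s → μ s * Y p (κ s))) →
    det k Z ≈ π * det k Y
  det-col-operation zero k Y Z c κ μ π 1≤c c≤k _ Z≈Y Zc = begin
    det k Z
      ≈⟨ det-linear-col k Z Y Y₀ c π 1≤c c≤k Z≈Y (λ p q q≢c → trans (Z≈Y p q q≢c) (sym (setCol-≢ Y c _ p q q≢c)))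
           (λ p → trans (Zc p) (+-congˡ (trans -0#≈0# (sym (setCol-≡ Y c _ p))))) ⟩
    π * det k Y + det k Y₀
      ≈⟨ +-congˡ (det-zero-col k Y₀ c 1≤c c≤k (setCol-≡ Y c _)) ⟩
    π * det k Y + 0#
      ≈⟨ +-identityʳ _ ⟩
    π * det k Y ∎
    where
    Y₀ = setCol Y c (λ _ → 0#)
  det-col-operation (suc m) k Y Z c κ μ π 1≤c c≤k κ-range Z≈Y Zc = begin
    det k Z                               ≈⟨ det-linear-col k Z Y₁ Z′ c (- μ (suc m)) 1≤c c≤k
                                               (λ p q q≢c → trans (Z≈Y p q q≢c) (sym (setCol-≢ Y c _ p q q≢c)))
                                               (λ p q q≢c → trans (Z≈Y p q q≢c) (sym (setCol-≢ Y c _ p q q≢c))) split ⟩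
    - μ (suc m) * det k Y₁ + det k Z′      ≈⟨ +-cong (trans (*-congˡ Y₁≈0) (zeroʳ _)) previous ⟩
    0# + π * det k Y                       ≈⟨ +-identityˡ _ ⟩
    π * det k Y                            ∎
    where
    S : ℕ → Carrier
    S p = sumTo m (λ s → μ s * Y p (κ s))
    Z′ = setCol Y c (λ p → π * Y p c - S p)
    Y₁ = setCol Y c (λ p → Y p (κ (suc m)))
    κ₁-range = κ-range (suc m) (s≤s z≤n) ≤-refl
    κ₁≥1 = proj₁ κ₁-range
    κ₁≤k = proj₁ (proj₂ κ₁-range)
    κ₁≢c = proj₂ (proj₂ κ₁-range)

    previous : det k Z′ ≈ π * det k Y
    previous = det-col-operation m k Y Z′ c κ μ π 1≤c c≤k (λ s 1≤s s≤m → κ-range s 1≤s (m≤n⇒m≤1+n s≤m))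
      (λ p q q≢c → setCol-≢ Y c _ p q q≢c) (λ p → setCol-≡ Y c _ p)

    split : ∀ p → Z p c ≈ - μ (suc m) * Y₁ p c + Z′ p c
    split p = trans (Zc p) (trans (x-[y+z]≈-z+[x-y] _ _ _)
      (+-cong (trans (-‿distribˡ-* _ _) (*-congˡ (sym (setCol-≡ Y c _ p)))) (sym (setCol-≡ Y c _ p))))

    Y₁-cols : ∀ p → Y₁ p c ≈ Y₁ p (κ (suc m))
    Y₁-cols p = trans (setCol-≡ Y c _ p) (sym (setCol-≢ Y c _ p _ κ₁≢c))

    Y₁≈0 : det k Y₁ ≈ 0#
    Y₁≈0 with c <? κ (suc m)
    ... | yes c<κ₁ = det-equal-cols k Y₁ c _ 1≤c c<κ₁ κ₁≤k Y₁-cols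
    ... | no c≮κ₁  = det-equal-cols k Y₁ _ c κ₁≥1 (≤∧≢⇒< (≮⇒≥ c≮κ₁) κ₁≢c) c≤k (λ p → sym (Y₁-cols p))

  det-first-col-zero : ∀ k Y → (∀ p → 2 ≤ p → p ≤ suc k → Y p 1 ≈ 0#) →
                       det (suc k) Y ≈ Y 1 1 * det k (minor Y 1 1)
  det-first-col-zero k Y below≈0 = begin
    det (suc k) Y
      ≈⟨ det-expand-col₁ k Y ⟩
    sumTo (suc k) (λ p → alt (p ∸ 1) (Y p 1 * det k (minor Y p 1)))
      ≈⟨ sumTo-unfoldˡ k _ ⟩
    Y 1 1 * det k (minor Y 1 1) + sumTo k (λ p → alt p (Y (suc p) 1 * det k (minor Y (suc p) 1)))
      ≈⟨ +-congˡ (sumTo-zero k λ p 1≤p p≤k →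
           trans (alt-cong p (trans (*-congʳ (below≈0 (suc p) (s≤s 1≤p) (s≤s p≤k))) (zeroˡ _))) (alt-zero p)) ⟩
    Y 1 1 * det k (minor Y 1 1) + 0#
      ≈⟨ +-identityʳ _ ⟩
    Y 1 1 * det k (minor Y 1 1) ∎

  toFront : ℕ → Mat → Mat
  toFront a X p zero          = X p zero
  toFront a X p (suc zero)    = X p a
  toFront a X p (suc (suc q)) = X p (skip a (suc q))

  toFront-suc : ∀ a X p q → 1 ≤ q → toFront a X p (suc q) ≡ X p (skip a q)
  toFront-suc a X p (suc q) _ = ≡.refl

  det-toFront : ∀ k X a → 1 ≤ a → a ≤ k → det k (toFront a X) ≈ alt (a ∸ 1) (det k X)
  det-toFront k X (suc zero) _ _ = det-cong k _ _ same
    where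
    same : ∀ p q → toFront 1 X p q ≈ X p q
    same p zero          = refl
    same p (suc zero)    = refl
    same p (suc (suc q)) = refl
  det-toFront k X (suc (suc a)) _ 2+a≤k = begin
    det k (toFront (suc (suc a)) X) ≈⟨ det-cong k _ _ via-swap ⟩
    det k (toFront (suc a) X′)      ≈⟨ det-toFront k X′ (suc a) (s≤s z≤n) (≤-trans (n≤1+n _) 2+a≤k) ⟩
    alt a (det k X′)                ≈⟨ alt-cong a (det-swap-adjacent-cols k X X′ (suc a) (s≤s z≤n) 2+a≤k
                                         (λ p → withCols-off X (suc a) p _ _) (λ p → withCols-₁ X (suc a) p _ _)
                                         (λ p → withCols-₂ X (suc a) p _ _)) ⟩
    alt a (- det k X)               ≈⟨ alt-neg a _ ⟩
    alt (suc a) (det k X)           ∎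
    where
    next this : ℕ → Carrier
    next p = X p (suc (suc a))
    this p = X p (suc a)
    X′ = withCols X (suc a) next this
    via-swap : ∀ p q → toFront (suc (suc a)) X p q ≈ toFront (suc a) X′ p q
    via-swap p zero          = sym (withCols-off X (suc a) p next this 0 (λ ()) (λ ()))
    via-swap p (suc zero)    = sym (withCols-₁ X (suc a) p _ _)
    via-swap p (suc (suc q)) with suc q <? suc a | suc q ≟ suc a
    ... | yes q<a | _ = begin
      X p (skip (suc (suc a)) (suc q)) ≡⟨ ≡.cong (X p) (skip-< (m≤n⇒m≤1+n q<a)) ⟩
      X p (suc q)                      ≈⟨ sym (withCols-off X (suc a) p _ _ (suc q) (λ e → <-irrefl e q<a)
                                                  (λ e → <-irrefl e (m≤n⇒m≤1+n q<a))) ⟩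
      X′ p (suc q)                     ≡⟨ ≡.cong (X′ p) (≡.sym (skip-< q<a)) ⟩
      X′ p (skip (suc a) (suc q))      ∎
    ... | no _ | yes ≡.refl = begin
      X p (skip (suc (suc q)) (suc q)) ≡⟨ ≡.cong (X p) (skip-< {suc (suc q)} ≤-refl) ⟩
      X p (suc q)                      ≈⟨ sym (withCols-₂ X (suc q) p _ _) ⟩
      X′ p (suc (suc q))               ≡⟨ ≡.cong (X′ p) (≡.sym (skip-≥ {suc q} ≤-refl)) ⟩
      X′ p (skip (suc q) (suc q))      ∎
    ... | no q≮a | no q≢a = begin
      X p (skip (suc (suc a)) (suc q)) ≡⟨ ≡.cong (X p) (skip-≥ 2+a≤1+q) ⟩
      X p (suc (suc q))                ≈⟨ sym (withCols-off X (suc a) p _ _ (suc (suc q))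
                                                  (λ e → <-irrefl (≡.sym e) (<-trans (n<1+n _) (s≤s 2+a≤1+q)))
                                                  (λ e → <-irrefl (≡.sym e) (s≤s 2+a≤1+q))) ⟩
      X′ p (suc (suc q))               ≡⟨ ≡.cong (X′ p) (≡.sym (skip-≥ (≮⇒≥ q≮a))) ⟩
      X′ p (skip (suc a) (suc q))      ∎
      where
      2+a≤1+q = ≤∧≢⇒< (≮⇒≥ q≮a) (λ e → q≢a (≡.sym e))

  -- The Desnanot–Jacobi identity

  *-cancelˡ-nonzero : ∀ {π x y} → ¬ (π ≈ 0#) → π * x ≈ π * y → x ≈ y
  *-cancelˡ-nonzero {π} {x} {y} π≉0 πx≈πy = begin
    x                ≈⟨ sym (*-identityˡ x) ⟩
    1# * x           ≈⟨ *-congʳ (sym π⁻¹π≈1) ⟩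
    (π ⁻¹ * π) * x   ≈⟨ *-assoc _ _ _ ⟩
    π ⁻¹ * (π * x)   ≈⟨ *-congˡ πx≈πy ⟩
    π ⁻¹ * (π * y)   ≈⟨ sym (*-assoc _ _ _) ⟩
    (π ⁻¹ * π) * y   ≈⟨ *-congʳ π⁻¹π≈1 ⟩
    1# * y           ≈⟨ *-identityˡ y ⟩
    y                ∎
    where
    π⁻¹π≈1 = trans (*-comm _ _) (⁻¹-inverse π π≉0)

  *-⁻¹-cancelʳ : ∀ {x d} → ¬ (d ≈ 0#) → (x * d) * d ⁻¹ ≈ x
  *-⁻¹-cancelʳ {x} {d} d≉0 = trans (*-assoc _ _ _) (trans (*-congˡ (⁻¹-inverse d d≉0)) (*-identityʳ x))

  -- X with rows a < b and columns c < d deleted.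
  minor₂ : Mat → ℕ → ℕ → ℕ → ℕ → Mat
  minor₂ X a b c d = minor (minor X a c) (b ∸ 1) (d ∸ 1)

  DesnanotJacobi : ℕ → Mat → ℕ → ℕ → ℕ → ℕ → Set ℓ′
  DesnanotJacobi m X a b c d = ¬ (det m (minor₂ X a b c d) ≈ 0#) →
    det (suc (suc m)) X * det m (minor₂ X a b c d) ≈
    det (suc m) (minor X a c) * det (suc m) (minor X b d) - det (suc m) (minor X a d) * det (suc m) (minor X b c)

  -- With π = det X_{3…n+2, 3…n+2}, Cramer's rule gives coefficients μ c s for which
  -- u c = π · (column c) - Σ μ c s · (column s+2) vanishes below row 2: u c ρ is the row-1
  -- expansion of bordered ρ c, which has two equal rows.  Replacing columns 1, 2 of X by u 1, u 2
  -- multiplies det X by π² and leaves a block-triangular matrix.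
  module DesnanotJacobi₁₂ (n : ℕ) (X : Mat) where

    π : Carrier
    π = det n (minor₂ X 1 2 1 2)

    border : ℕ → ℕ → ℕ
    border x zero          = zero
    border x (suc zero)    = x
    border x (suc (suc j)) = suc (suc (suc j))

    -- rows r, 3, 4, … and columns c, 3, 4, … of X
    bordered : ℕ → ℕ → Mat
    bordered r c p q = X (border r p) (border c q)

    μ : ℕ → ℕ → Carrier
    μ c s = alt (suc s) (det n (minor (bordered 1 c) 1 (suc s)))

    u : ℕ → ℕ → Carrier
    u c p = π * X p c - sumTo n (λ s → μ c s * X p (suc (suc s)))

    u-vanishes : ∀ c r → 1 ≤ r → r ≤ n → u c (suc (suc r)) ≈ 0#
    u-vanishes c (suc r) _ r≤n = begin
      π * x - sumTo n (λ s → μ c s * X ρ (suc (suc s)))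
        ≈⟨ +-cong (*-comm _ _) (trans (sumTo-neg n _) (sumTo-cong n negated-terms)) ⟩
      x * π + sumTo n (λ s → alt s (W 1 (suc s) * det n (minor W 1 (suc s))))
        ≈⟨ sym (+-congʳ (*-congˡ (det-cong-on n _ _ λ { (suc p) (suc q) _ _ _ _ → refl }))) ⟩
      W 1 1 * det n (minor W 1 1) + sumTo n (λ s → alt s (W 1 (suc s) * det n (minor W 1 (suc s))))
        ≈⟨ sym (sumTo-unfoldˡ n _) ⟩
      det (suc n) W
        ≈⟨ det-equal-rows (suc n) W 1 (suc (suc r)) (s≤s z≤n) (s≤s (s≤s z≤n)) (s≤s r≤n) (λ _ → refl) ⟩
      0# ∎
      where
      ρ = suc (suc (suc r))
      x = X ρ c
      W = bordered ρ c
      same-minor : ∀ s → det n (minor (bordered 1 c) 1 (suc s)) ≈ det n (minor W 1 (suc s))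
      same-minor s = det-cong-on n _ _ λ { (suc p) q _ _ _ _ → refl }
      negated-terms : ∀ s → 1 ≤ s → s ≤ n →
        - (μ c s * X ρ (suc (suc s))) ≈ alt s (W 1 (suc s) * det n (minor W 1 (suc s)))
      negated-terms (suc s) _ _ = begin
        - (alt (suc (suc s)) D * y)   ≈⟨ -‿cong (alt-*ˡ (suc (suc s)) D y) ⟩
        - - - alt s (D * y)           ≈⟨ -‿involutive _ ⟩
        - alt s (D * y)               ≈⟨ -‿cong (alt-cong s (trans (*-comm _ _) (*-congˡ (same-minor (suc s))))) ⟩
        alt (suc s) (W 1 (suc (suc s)) * det n (minor W 1 (suc (suc s)))) ∎
        where
        D = det n (minor (bordered 1 c) 1 (suc (suc s)))
        y = X ρ (suc (suc (suc s)))

    X₁ Xᵤ : Mat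
    X₁ = setCol X 1 (u 1)
    Xᵤ = setCol X₁ 2 (u 2)

    Xᵤ-col₁ : ∀ p → Xᵤ p 1 ≈ u 1 p
    Xᵤ-col₁ p = trans (setCol-≢ X₁ 2 (u 2) p 1 (λ ())) (setCol-≡ X 1 (u 1) p)

    Xᵤ-col₂ : ∀ p → Xᵤ p 2 ≈ u 2 p
    Xᵤ-col₂ p = setCol-≡ X₁ 2 (u 2) p

    Xᵤ-col : ∀ p q → Xᵤ p (suc (suc (suc q))) ≈ X p (suc (suc (suc q)))
    Xᵤ-col p q = trans (setCol-≢ X₁ 2 (u 2) p (3 N.+ q) (λ ())) (setCol-≢ X 1 (u 1) p (3 N.+ q) (λ ()))

    det-Xᵤ : det (suc (suc n)) Xᵤ ≈ π * (π * det (suc (suc n)) X)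
    det-Xᵤ = trans
      (det-col-operation n _ X₁ Xᵤ 2 (λ s → suc (suc s)) (μ 2) π (s≤s z≤n) (s≤s (s≤s z≤n))
        (λ { (suc s) _ s≤n → s≤s z≤n , s≤s (s≤s s≤n) , (λ ()) })
        (λ p q q≢2 → setCol-≢ X₁ 2 (u 2) p q q≢2)
        (λ p → trans (Xᵤ-col₂ p) (+-cong (*-congˡ (sym (setCol-≢ X 1 (u 1) p 2 (λ ()))))
                 (-‿cong (sumTo-cong n λ { (suc s) _ _ → *-congˡ (sym (setCol-≢ X 1 (u 1) p (3 N.+ s) (λ ()))) })))))
      (*-congˡ (det-col-operation n _ X X₁ 1 (λ s → suc (suc s)) (μ 1) π (s≤s z≤n) (s≤s z≤n)
        (λ { (suc s) _ s≤n → s≤s z≤n , s≤s (s≤s s≤n) , (λ ()) })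
        (λ p q q≢1 → setCol-≢ X 1 (u 1) p q q≢1) (λ p → setCol-≡ X 1 (u 1) p)))

    module _ (a : ℕ) (1≤a : 1 ≤ a) (a≤2 : a ≤ 2) where

      skip-a : ∀ p → skip a (suc (suc p)) ≡ suc (suc (suc p))
      skip-a p = skip-≥ (≤-trans a≤2 (s≤s (s≤s z≤n)))

      det-minor-Xᵤ : ∀ b → 1 ≤ b → b ≤ 2 → (∀ p → Xᵤ p (skip b 1) ≈ u (skip b 1) p) →
                     det (suc n) (minor Xᵤ a b) ≈ π * det (suc n) (minor X a b)
      det-minor-Xᵤ b 1≤b b≤2 Xᵤ-col-b̄ = det-col-operation n (suc n) (minor X a b) (minor Xᵤ a b) 1 suc (μ (skip b 1)) π
        (s≤s z≤n) (s≤s z≤n) (λ { (suc s) _ s≤n → s≤s z≤n , s≤s s≤n , (λ ()) }) other-cols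
        (λ p → trans (Xᵤ-col-b̄ _) (+-congˡ (-‿cong (sumTo-cong n λ { (suc s) _ _ →
                 *-congˡ (reflexive (≡.cong (X _) (≡.sym (skip-b s)))) }))))
        where
        skip-b : ∀ q → skip b (suc (suc q)) ≡ suc (suc (suc q))
        skip-b q = skip-≥ (≤-trans b≤2 (s≤s (s≤s z≤n)))
        other-cols : ∀ p q → q ≢ 1 → minor Xᵤ a b p q ≈ minor X a b p q
        other-cols p zero _ = begin
          Xᵤ (skip a p) (skip b 0) ≡⟨ ≡.cong (Xᵤ _) (skip-< 1≤b) ⟩
          Xᵤ (skip a p) 0          ≈⟨ trans (setCol-≢ X₁ 2 (u 2) _ 0 (λ ())) (setCol-≢ X 1 (u 1) _ 0 (λ ())) ⟩
          X (skip a p) 0           ≡⟨ ≡.cong (X _) (≡.sym (skip-< 1≤b)) ⟩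
          X (skip a p) (skip b 0)  ∎
        other-cols p (suc zero) q≢1 = ⊥-elim (q≢1 ≡.refl)
        other-cols p (suc (suc q)) _ = begin
          Xᵤ (skip a p) (skip b (suc (suc q))) ≡⟨ ≡.cong (Xᵤ _) (skip-b q) ⟩
          Xᵤ (skip a p) (suc (suc (suc q)))    ≈⟨ Xᵤ-col _ q ⟩
          X (skip a p) (suc (suc (suc q)))     ≡⟨ ≡.cong (X _) (≡.sym (skip-b q)) ⟩
          X (skip a p) (skip b (suc (suc q)))  ∎

      det-minor-Xᵤ-triangular : det (suc n) (minor Xᵤ a 2) ≈ u 1 (skip a 1) * π
      det-minor-Xᵤ-triangular = begin
        det (suc n) (minor Xᵤ a 2)
          ≈⟨ det-first-col-zero n (minor Xᵤ a 2) below ⟩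
        Xᵤ (skip a 1) 1 * det n (minor (minor Xᵤ a 2) 1 1)
          ≈⟨ *-cong (Xᵤ-col₁ _) (det-cong-on n _ _ λ { (suc p) (suc q) _ _ _ _ →
               trans (reflexive (≡.cong (λ r → Xᵤ r (suc (suc (suc q)))) (skip-a p))) (Xᵤ-col _ q) }) ⟩
        u 1 (skip a 1) * π ∎
        where
        below : ∀ p → 2 ≤ p → p ≤ suc n → Xᵤ (skip a p) 1 ≈ 0#
        below (suc zero) (s≤s ()) _
        below (suc (suc p)) _ (s≤s p<n) = begin
          Xᵤ (skip a (suc (suc p))) 1 ≡⟨ ≡.cong (λ r → Xᵤ r 1) (skip-a p) ⟩
          Xᵤ (suc (suc (suc p))) 1    ≈⟨ Xᵤ-col₁ _ ⟩
          u 1 (suc (suc (suc p)))     ≈⟨ u-vanishes 1 (suc p) (s≤s z≤n) p<n ⟩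
          0#                          ∎

    det-Xᵤ-expand : det (suc (suc n)) Xᵤ ≈
      u 1 1 * det (suc n) (minor Xᵤ 1 1) - u 1 2 * det (suc n) (minor Xᵤ 2 1)
    det-Xᵤ-expand = begin
      det (suc (suc n)) Xᵤ
        ≈⟨ det-expand-col₁ (suc n) Xᵤ ⟩
      sumTo (suc (suc n)) term
        ≈⟨ sumTo-unfoldˡ (suc n) term ⟩
      term 1 + sumTo (suc n) (λ p → term (suc p))
        ≈⟨ +-congˡ (sumTo-unfoldˡ n _) ⟩
      term 1 + (term 2 + sumTo n (λ p → term (suc (suc p))))
        ≈⟨ +-congˡ (trans (+-congˡ (sumTo-zero n λ p 1≤p p≤n →
             trans (alt-cong (suc p) (trans (*-congʳ (trans (Xᵤ-col₁ _) (u-vanishes 1 p 1≤p p≤n))) (zeroˡ _)))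
                   (alt-zero (suc p))))
             (+-identityʳ _)) ⟩
      term 1 + term 2
        ≈⟨ +-cong (*-congʳ (Xᵤ-col₁ 1)) (-‿cong (*-congʳ (Xᵤ-col₁ 2))) ⟩
      u 1 1 * det (suc n) (minor Xᵤ 1 1) - u 1 2 * det (suc n) (minor Xᵤ 2 1) ∎
      where
      term : ℕ → Carrier
      term p = alt (p ∸ 1) (Xᵤ p 1 * det (suc n) (minor Xᵤ p 1))

    desnanotJacobi₁₂ : DesnanotJacobi n X 1 2 1 2
    desnanotJacobi₁₂ π≉0 = trans (*-comm _ _) (*-cancelˡ-nonzero π≉0 (begin
      π * (π * det (suc (suc n)) X)           ≈⟨ sym det-Xᵤ ⟩
      det (suc (suc n)) Xᵤ                    ≈⟨ det-Xᵤ-expand ⟩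
      u 1 1 * det (suc n) (minor Xᵤ 1 1) - u 1 2 * det (suc n) (minor Xᵤ 2 1)
        ≈⟨ +-cong (*-congˡ (det-minor-Xᵤ 1 (s≤s z≤n) (s≤s z≤n) 1 (s≤s z≤n) (s≤s z≤n) Xᵤ-col₂))
                  (-‿cong (*-congˡ (det-minor-Xᵤ 2 (s≤s z≤n) ≤-refl 1 (s≤s z≤n) (s≤s z≤n) Xᵤ-col₂))) ⟩
      u 1 1 * (π * d 1 1) - u 1 2 * (π * d 2 1)
        ≈⟨ +-cong (pull (u-from-minor 2 (s≤s z≤n) ≤-refl)) (-‿cong (pull (u-from-minor 1 (s≤s z≤n) (s≤s z≤n)))) ⟩
      π * (d 2 2 * d 1 1) - π * (d 1 2 * d 2 1) ≈⟨ sym (x[y-z]≈xy-xz _ _ _) ⟩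
      π * (d 2 2 * d 1 1 - d 1 2 * d 2 1)     ≈⟨ *-congˡ (+-congʳ (*-comm _ _)) ⟩
      π * (d 1 1 * d 2 2 - d 1 2 * d 2 1)     ∎))
      where
      d : ℕ → ℕ → Carrier
      d a b = det (suc n) (minor X a b)

      -- minor Xᵤ a 2 is both block triangular and a column operation on minor X a 2
      u-from-minor : ∀ a → 1 ≤ a → a ≤ 2 → u 1 (skip a 1) * π ≈ π * d a 2
      u-from-minor a 1≤a a≤2 = trans (sym (det-minor-Xᵤ-triangular a 1≤a a≤2))
                                     (det-minor-Xᵤ a 1≤a a≤2 2 (s≤s z≤n) ≤-refl Xᵤ-col₁)

      pull : ∀ {x y z} → x * π ≈ π * y → x * (π * z) ≈ π * (y * z)
      pull {x} {y} {z} xπ≈πy = trans (sym (*-assoc _ _ _)) (trans (*-congʳ xπ≈πy) (*-assoc _ _ _))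

  desnanotJacobi-transpose : ∀ m X a b c d → DesnanotJacobi m (transpose X) c d a b → DesnanotJacobi m X a b c d
  desnanotJacobi-transpose m X a b c d DJᵀ π≉0 = begin
    det (suc (suc m)) X * det m (minor₂ X a b c d)
      ≈⟨ sym (*-cong (det-transpose (suc (suc m)) X) (det-transpose m (minor₂ X a b c d))) ⟩
    det (suc (suc m)) (transpose X) * det m (minor₂ (transpose X) c d a b)
      ≈⟨ DJᵀ (λ π≈0 → π≉0 (trans (sym (det-transpose m _)) π≈0)) ⟩
    Dᵀ c a * Dᵀ d b - Dᵀ c b * Dᵀ d a
      ≈⟨ +-cong (*-cong (D≈ a c) (D≈ b d)) (-‿cong (trans (*-comm _ _) (*-cong (D≈ a d) (D≈ b c)))) ⟩
    det (suc m) (minor X a c) * det (suc m) (minor X b d) - det (suc m) (minor X a d) * det (suc m) (minor X b c) ∎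
    where
    Dᵀ : ℕ → ℕ → Carrier
    Dᵀ i j = det (suc m) (minor (transpose X) i j)
    D≈ : ∀ i j → Dᵀ j i ≈ det (suc m) (minor X i j)
    D≈ i j = det-transpose (suc m) (minor X i j)

  module _ (X : Mat) (c d : ℕ) where
    private
      Z = toFront (suc (suc d)) X
      Y = toFront (suc (suc c)) Z

    minor-toFront²-col₁ : c ≤ d → ∀ r p q → 1 ≤ q → minor Y r 1 p q ≈ toFront (suc d) (minor X r (suc c)) p q
    minor-toFront²-col₁ c≤d r p (suc zero) _ = reflexive (≡.cong (X _) (≡.sym (skip-≥ {suc c} (s≤s c≤d))))
    minor-toFront²-col₁ c≤d r p (suc (suc q)) _ = begin
      Z (skip r p) (skip (suc (suc c)) (suc (suc q)))
        ≡⟨ ≡.cong (Z _) (skip-suc (suc c) (suc q)) ⟩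
      Z (skip r p) (suc (skip (suc c) (suc q)))
        ≡⟨ toFront-suc _ X _ _ (≤-trans (s≤s z≤n) (p≤skip (suc c) (suc q))) ⟩
      X (skip r p) (skip (suc (suc d)) (skip (suc c) (suc q)))
        ≡⟨ ≡.cong (X _) (≡.sym (skip-skip (suc q) (s≤s c≤d))) ⟩
      X (skip r p) (skip (suc c) (skip (suc d) (suc q))) ∎

    minor-toFront²-col₂ : ∀ r p q → 1 ≤ q → minor Y r 2 p q ≈ toFront (suc c) (minor X r (suc (suc d))) p q
    minor-toFront²-col₂ r p (suc zero) _ = reflexive (toFront-suc (suc (suc d)) X _ (suc c) (s≤s z≤n))
    minor-toFront²-col₂ r p (suc (suc q)) _ = reflexive (≡.trans (≡.cong (Z _) (skip-suc (suc c) (suc q)))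
      (toFront-suc (suc (suc d)) X _ _ (≤-trans (s≤s z≤n) (p≤skip (suc c) (suc q)))))

  -- Moving columns d and c to the front multiplies both sides by (-1)^(c+d), up to an even power.
  desnanotJacobi-toFront : ∀ n X a b c d → 1 ≤ c → c < d → d ≤ suc (suc n) →
    DesnanotJacobi n (toFront (suc c) (toFront d X)) a b 1 2 → DesnanotJacobi n X a b c d
  desnanotJacobi-toFront n X a b (suc c) (suc (suc d)) _ (s≤s (s≤s c≤d)) d′≤2+n DJ π≉0 =
    alt-injective (c N.+ d) (begin
      alt (c N.+ d) (det N X * π)
        ≈⟨ sym (-‿involutive _) ⟩
      alt (suc (suc (c N.+ d))) (det N X * π)
        ≡⟨ ≡.cong (λ e → alt (suc e) (det N X * π)) (≡.sym (ℕₚ.+-suc c d)) ⟩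
      alt (suc c N.+ suc d) (det N X * π)
        ≈⟨ sym (trans (alt-*ˡ (suc c) _ _) (trans (alt-cong (suc c) (alt-*ˡ (suc d) _ _)) (alt-alt (suc c) (suc d) _))) ⟩
      alt (suc c) (alt (suc d) (det N X)) * π
        ≈⟨ sym (*-cong det-Y π-Y) ⟩
      det N Y * det n (minor₂ Y a b 1 2)
        ≈⟨ DJ (λ π-Y≈0 → π≉0 (trans (sym π-Y) π-Y≈0)) ⟩
      det (suc n) (minor Y a 1) * det (suc n) (minor Y b 2) - det (suc n) (minor Y a 2) * det (suc n) (minor Y b 1)
        ≈⟨ +-cong (*-cong (det-minor-Y₁ a) (det-minor-Y₂ b)) (-‿cong (*-cong (det-minor-Y₂ a) (det-minor-Y₁ b))) ⟩
      alt d (A a c′) * alt c (A b d′) - alt c (A a d′) * alt d (A b c′)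
        ≈⟨ +-cong (alt-*-alt d c _ _) (-‿cong (alt-*-alt c d _ _)) ⟩
      alt (d N.+ c) (A a c′ * A b d′) - alt (c N.+ d) (A a d′ * A b c′)
        ≡⟨ ≡.cong (λ e → alt e (A a c′ * A b d′) - alt (c N.+ d) (A a d′ * A b c′)) (ℕₚ.+-comm d c) ⟩
      alt (c N.+ d) (A a c′ * A b d′) - alt (c N.+ d) (A a d′ * A b c′)
        ≈⟨ alt-‿- (c N.+ d) _ _ ⟩
      alt (c N.+ d) (A a c′ * A b d′ - A a d′ * A b c′) ∎)
    where
    N = suc (suc n)
    c′ = suc c
    d′ = suc (suc d)
    Z = toFront d′ X
    Y = toFront (suc c′) Z
    π = det n (minor₂ X a b c′ d′)
    A : ℕ → ℕ → Carrier
    A r q = det (suc n) (minor X r q)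

    det-Y : det N Y ≈ alt (suc c) (alt (suc d) (det N X))
    det-Y = trans (det-toFront N Z (suc c′) (s≤s z≤n) (<-≤-trans (s≤s (s≤s c≤d)) d′≤2+n))
                  (alt-cong (suc c) (det-toFront N X d′ (s≤s z≤n) d′≤2+n))

    det-minor-Y₁ : ∀ r → det (suc n) (minor Y r 1) ≈ alt d (A r c′)
    det-minor-Y₁ r = trans (det-cong-on (suc n) _ _ λ p q _ _ 1≤q _ → minor-toFront²-col₁ X c d c≤d r p q 1≤q)
      (det-toFront (suc n) (minor X r c′) (suc d) (s≤s z≤n) (≤-pred d′≤2+n))

    det-minor-Y₂ : ∀ r → det (suc n) (minor Y r 2) ≈ alt c (A r d′)
    det-minor-Y₂ r = trans (det-cong-on (suc n) _ _ λ p q _ _ 1≤q _ → minor-toFront²-col₂ X c d r p q 1≤q)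
      (det-toFront (suc n) (minor X r d′) c′ (s≤s z≤n) (≤-trans (s≤s c≤d) (≤-pred d′≤2+n)))

    π-Y : det n (minor₂ Y a b 1 2) ≈ π
    π-Y = det-cong-on n _ _ λ { p (suc q) _ _ _ _ → minor-toFront²-col₁ X c d c≤d a _ (suc (suc q)) (s≤s z≤n) }

  desnanotJacobi : ∀ n X a b c d → 1 ≤ a → a < b → b ≤ suc (suc n) → 1 ≤ c → c < d → d ≤ suc (suc n) →
                   DesnanotJacobi n X a b c d
  desnanotJacobi n X a b c d 1≤a a<b b≤2+n 1≤c c<d d≤2+n =
    desnanotJacobi-toFront n X a b c d 1≤c c<d d≤2+n
      (desnanotJacobi-transpose n Y a b 1 2
        (desnanotJacobi-toFront n (transpose Y) 1 2 a b 1≤a a<b b≤2+n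
          (DesnanotJacobi₁₂.desnanotJacobi₁₂ n (toFront (suc a) (toFront b (transpose Y))))))
    where
    Y = toFront (suc c) (toFront d X)

  -- Dodgson's method

  Dodgson-step : ∀ A t p q →
    Dodgson A (suc (suc t)) p q ≡ cond (Dodgson A (suc t)) p q * (Dodgson A t (suc p) (suc q)) ⁻¹
  Dodgson-step A t p q with steps A t
  ... | X , Y = ≡.refl

  DodgsonCorrectAt : Mat → ℕ → ℕ → ℕ → Set ℓ′
  DodgsonCorrectAt A n k t = t ≤ n ∸ k →
    ∀ p q → 1 ≤ p → p ≤ n ∸ t → 1 ≤ q → q ≤ n ∸ t → Dodgson A t p q ≈ det (suc t) (sub A p q)

  det-condensation : ∀ A t p q → 1 ≤ p → 1 ≤ q → ¬ (det (suc t) (sub A (suc p) (suc q)) ≈ 0#) →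
    let block = λ p q → det (suc (suc t)) (sub A p q) in
    det (suc (suc (suc t))) (sub A p q) * det (suc t) (sub A (suc p) (suc q)) ≈
    block p q * block (suc p) (suc q) - block (suc p) q * block p (suc q)
  det-condensation A t p q 1≤p 1≤q interior≉0 = begin
    det N X * det (suc t) (sub A (suc p) (suc q))
      ≈⟨ *-congˡ (sym interior) ⟩
    det N X * det (suc t) (minor₂ X 1 N 1 N)
      ≈⟨ desnanotJacobi (suc t) X 1 N 1 N (s≤s z≤n) (s≤s (s≤s z≤n)) ≤-refl (s≤s z≤n) (s≤s (s≤s z≤n)) ≤-refl
           (λ e → interior≉0 (trans (sym interior) e)) ⟩
    D (minor X 1 1) * D (minor X N N) - D (minor X 1 N) * D (minor X N 1)
      ≈⟨ +-cong (trans (*-cong minor-11 minor-NN) (*-comm _ _)) (-‿cong (*-cong minor-1N minor-N1)) ⟩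
    block p q * block (suc p) (suc q) - block (suc p) q * block p (suc q) ∎
    where
    N = suc (suc (suc t))
    X = sub A p q
    D : Mat → Carrier
    D = det (suc (suc t))
    block : ℕ → ℕ → Carrier
    block p q = D (sub A p q)
    last : ∀ a i → i ≤ suc (suc t) → a ∸ 1 N.+ skip N i ≡ a ∸ 1 N.+ i
    last a i i≤ = ≡.cong (a ∸ 1 N.+_) (skip-< (s≤s i≤))
    interior : det (suc t) (minor₂ X 1 N 1 N) ≈ det (suc t) (sub A (suc p) (suc q))
    interior = det-cong-on (suc t) _ _ λ i j 1≤i i≤ 1≤j j≤ → reflexive (≡.cong₂ A
      (≡.trans (≡.cong (λ r → p ∸ 1 N.+ skip 1 r) (skip-< (s≤s i≤))) (corner-shift i 1≤p 1≤i))
      (≡.trans (≡.cong (λ r → q ∸ 1 N.+ skip 1 r) (skip-< (s≤s j≤))) (corner-shift j 1≤q 1≤j)))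
    minor-11 : D (minor X 1 1) ≈ block (suc p) (suc q)
    minor-11 = det-cong-on (suc (suc t)) _ _
      λ i j 1≤i _ 1≤j _ → reflexive (≡.cong₂ A (corner-shift i 1≤p 1≤i) (corner-shift j 1≤q 1≤j))
    minor-NN : D (minor X N N) ≈ block p q
    minor-NN = det-cong-on (suc (suc t)) _ _
      λ i j _ i≤ _ j≤ → reflexive (≡.cong₂ A (last p i i≤) (last q j j≤))
    minor-1N : D (minor X 1 N) ≈ block (suc p) q
    minor-1N = det-cong-on (suc (suc t)) _ _
      λ i j 1≤i _ _ j≤ → reflexive (≡.cong₂ A (corner-shift i 1≤p 1≤i) (last q j j≤))
    minor-N1 : D (minor X N 1) ≈ block p (suc q)
    minor-N1 = det-cong-on (suc (suc t)) _ _
      λ i j _ i≤ 1≤j _ → reflexive (≡.cong₂ A (last p i i≤) (corner-shift j 1≤q 1≤j))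

  Dodgson-correct-step : ∀ A n k t → Succeeds A n k → DodgsonCorrectAt A n k t → DodgsonCorrectAt A n k (suc t) →
                         DodgsonCorrectAt A n k (suc (suc t))
  Dodgson-correct-step A n k t ok level₀ level₁ 2+t≤n∸k p q 1≤p p≤ 1≤q q≤ = begin
    Dodgson A (suc (suc t)) p q
      ≡⟨ Dodgson-step A t p q ⟩
    cond (Dodgson A (suc t)) p q * divisor ⁻¹
      ≈⟨ *-congʳ (+-cong
           (*-cong (level₁′ p q 1≤p p≤₁ 1≤q q≤₁)
                   (level₁′ (suc p) (suc q) (s≤s z≤n) 1+p≤ (s≤s z≤n) 1+q≤))
           (-‿cong (*-cong (level₁′ (suc p) q (s≤s z≤n) 1+p≤ 1≤q q≤₁)
                           (level₁′ p (suc q) 1≤p p≤₁ (s≤s z≤n) 1+q≤)))) ⟩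
    (block p q * block (suc p) (suc q) - block (suc p) q * block p (suc q)) * divisor ⁻¹
      ≈⟨ *-congʳ (sym (det-condensation A t p q 1≤p 1≤q (λ e → divisor≉0 (trans divisor≈minor e)))) ⟩
    (det (suc (suc (suc t))) (sub A p q) * det (suc t) (sub A (suc p) (suc q))) * divisor ⁻¹
      ≈⟨ *-congʳ (*-congˡ (sym divisor≈minor)) ⟩
    (det (suc (suc (suc t))) (sub A p q) * divisor) * divisor ⁻¹
      ≈⟨ *-⁻¹-cancelʳ divisor≉0 ⟩
    det (suc (suc (suc t))) (sub A p q) ∎
    where
    divisor = Dodgson A t (suc p) (suc q)
    block : ℕ → ℕ → Carrier
    block p q = det (suc (suc t)) (sub A p q)
    p≤₁ = ≤-∸-suc {n = n} {s = suc t} p≤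
    q≤₁ = ≤-∸-suc {n = n} {s = suc t} q≤
    1+p≤ = suc-≤-∸ {n = n} {s = suc t} 1≤p p≤
    1+q≤ = suc-≤-∸ {n = n} {s = suc t} 1≤q q≤
    level₁′ = level₁ (≤-trans (n≤1+n _) 2+t≤n∸k)
    divisor≉0 : ¬ (divisor ≈ 0#)
    divisor≉0 = ok (suc (suc t)) p q (s≤s (s≤s z≤n)) 2+t≤n∸k 1≤p p≤ 1≤q q≤
    divisor≈minor : divisor ≈ det (suc t) (sub A (suc p) (suc q))
    divisor≈minor = level₀ (≤-trans (n≤1+n _) (≤-trans (n≤1+n _) 2+t≤n∸k)) (suc p) (suc q)
      (s≤s z≤n) (suc-≤-∸ {n = n} {s = t} 1≤p p≤₁) (s≤s z≤n) (suc-≤-∸ {n = n} {s = t} 1≤q q≤₁)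

  Dodgson-correct : ∀ A n k → Succeeds A n k → ∀ t → DodgsonCorrectAt A n k t
  Dodgson-correct A n k ok zero _ (suc p) (suc q) _ _ _ _ =
    sym (trans (det-1 (sub A (suc p) (suc q))) (reflexive (≡.cong₂ A (ℕₚ.+-comm p 1) (ℕₚ.+-comm q 1))))
  Dodgson-correct A n k ok (suc zero) _ (suc p) (suc q) _ _ _ _ = sym (trans (det-2 (sub A (suc p) (suc q)))
    (+-cong (*-cong (entry 1 1) (entry 2 2)) (-‿cong (trans (*-cong (entry 1 2) (entry 2 1)) (*-comm _ _)))))
    where
    entry : ∀ i j → A (p N.+ i) (q N.+ j) ≈ A (i N.+ p) (j N.+ q)
    entry i j = reflexive (≡.cong₂ A (ℕₚ.+-comm p i) (ℕₚ.+-comm q j))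
  Dodgson-correct A n k ok (suc (suc t)) =
    Dodgson-correct-step A n k t ok (Dodgson-correct A n k ok t) (Dodgson-correct A n k ok (suc t))

  det-M′ : ∀ n k → k ≤ n → (A : Mat) → Succeeds A n k →
    ∀ i j → 2 ≤ i → i ≤ k ∸ 1 → 2 ≤ j → j ≤ k ∸ 1 → ∀ r s →
    ¬ (Dodgson A (n ∸ k) (shift r i) (shift s j) ≈ 0#) →
    det 2 (M′ (calA A i j) (n ∸ k) r s) ≈
    det (suc (suc (suc (n ∸ k)))) (calA A i j) * Dodgson A (n ∸ k) (shift r i) (shift s j)
  det-M′ n k k≤n A ok i j 2≤i i≤k-1 2≤j j≤k-1 r s α≉0 = begin
    det 2 M
      ≈⟨ det-2 M ⟩
    M 1 1 * M 2 2 - M 1 2 * M 2 1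
      ≡⟨ ≡.cong₂ _-_ (≡.cong₂ _*_ (M-entry r₁ c₁) (M-entry r₂ c₂))
                     (≡.cong₂ _*_ (M-entry r₁ c₂) (M-entry r₂ c₁)) ⟩
    D r₁ c₁ * D r₂ c₂ - D r₁ c₂ * D r₂ c₁
      ≈⟨ sym (desnanotJacobi (suc ℓ) 𝒜 r₁ r₂ c₁ c₂ 1≤r₁ r₁<r₂ r₂≤ 1≤c₁ c₁<c₂ c₂≤
                λ π≈0 → α≉0 (trans (sym complement≈α) π≈0)) ⟩
    det (suc (suc (suc ℓ))) 𝒜 * det (suc ℓ) (minor₂ 𝒜 r₁ r₂ c₁ c₂)
      ≈⟨ *-congˡ complement≈α ⟩
    det (suc (suc (suc ℓ))) 𝒜 * α ∎
    where
    ℓ = n ∸ k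
    𝒜 = calA A i j
    M = M′ 𝒜 ℓ r s
    α = Dodgson A ℓ (shift r i) (shift s j)
    r₁ = remaining (corner r) ℓ 1
    r₂ = remaining (corner r) ℓ 2
    c₁ = remaining (corner s) ℓ 1
    c₂ = remaining (corner s) ℓ 2
    1≤r₁ = proj₁ (remaining-range r ℓ)
    r₁<r₂ = proj₁ (proj₂ (remaining-range r ℓ))
    r₂≤ = proj₂ (proj₂ (remaining-range r ℓ))
    1≤c₁ = proj₁ (remaining-range s ℓ)
    c₁<c₂ = proj₁ (proj₂ (remaining-range s ℓ))
    c₂≤ = proj₂ (proj₂ (remaining-range s ℓ))
    D : ℕ → ℕ → Carrier
    D x y = det (suc (suc ℓ)) (minor 𝒜 x y)
    M-entry : ∀ x y → det (ℓ N.+ 2) (minor 𝒜 x y) ≡ D x y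
    M-entry x y = ≡.cong (λ m → det m (minor 𝒜 x y)) (ℕₚ.+-comm ℓ 2)

    n∸ℓ≡k : n ∸ ℓ ≡ k
    n∸ℓ≡k = ℕₚ.m∸[m∸n]≡n k≤n
    in-range : ∀ r {i} → 2 ≤ i → i ≤ k ∸ 1 → 1 ≤ shift r i × shift r i ≤ n ∸ ℓ
    in-range r 2≤i i≤k-1 =
      let lower , upper = shift-range r 2≤i i≤k-1 in lower , ≡.subst (_ ≤_) (≡.sym n∸ℓ≡k) upper

    complement≈α : det (suc ℓ) (minor₂ 𝒜 r₁ r₂ c₁ c₂) ≈ α
    complement≈α = trans
      (det-cong-on (suc ℓ) _ _ λ x y 1≤x x≤ 1≤y y≤ →
        reflexive (≡.cong₂ A (skip-remaining r ℓ x 2≤i 1≤x x≤) (skip-remaining s ℓ y 2≤j 1≤y y≤)))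
      (sym (Dodgson-correct A n k ok ℓ ≤-refl (shift r i) (shift s j)
              (proj₁ (in-range r 2≤i i≤k-1)) (proj₂ (in-range r 2≤i i≤k-1))
              (proj₁ (in-range s 2≤j j≤k-1)) (proj₂ (in-range s 2≤j j≤k-1))))

theorem4p3 : ∀ {c ℓ′ : Level} (F : Field c ℓ′) →
  let open Field F
      open FieldDefs F
  in (n k : ℕ) → 3 ≤ k → k ≤ n → (A : Mat) → Succeeds A n k →
     (i j : ℕ) → 2 ≤ i → i ≤ k ∸ 1 → 2 ≤ j → j ≤ k ∸ 1 →
     Dodgson A (n ∸ k) i j ≈ 0# →
     (r s : Shift) →
     ¬ (Dodgson A (n ∸ k) (shift r i) (shift s j) ≈ 0#) →
     det 2 (M′ (calA A i j) (n ∸ k) r s)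
       * (Dodgson A (n ∸ k) (shift r i) (shift s j)) ⁻¹
       ≈ det (n ∸ k N.+ 3) (calA A i j)
theorem4p3 F n k _ k≤n A ok i j 2≤i i≤k-1 2≤j j≤k-1 _ r s α≉0 = begin
  det 2 (M′ 𝒜 ℓ r s) * α ⁻¹       ≈⟨ *-congʳ (det-M′ n k k≤n A ok i j 2≤i i≤k-1 2≤j j≤k-1 r s α≉0) ⟩
  (det (3 N.+ ℓ) 𝒜 * α) * α ⁻¹    ≈⟨ *-⁻¹-cancelʳ α≉0 ⟩
  det (3 N.+ ℓ) 𝒜                 ≡⟨ ≡.cong (λ m → det m 𝒜) (ℕₚ.+-comm 3 ℓ) ⟩
  det (ℓ N.+ 3) 𝒜                 ∎
  where
  open Field F hiding (zero)
  open FieldDefs F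
  open Condensation F
  open import Relation.Binary.Reasoning.Setoid setoid
  ℓ = n ∸ k
  𝒜 = calA A i j
  α = Dodgson A ℓ (shift r i) (shift s j)
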